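{- Let $m=(m_0,\dots,m_s)$ be a vector of odd integers $\ge3$, $G=\bigoplus_\ell\mathbb Z_{m_\ell}$, and let $(k,\kappa),(\tilde k,\tilde\kappa),(\hat k,\hat\kappa)\in G\times G$ be distinct. Then $$\langle\pi(k,\kappa)\psi,\pi(\tilde k,\tilde\kappa)\psi\rangle\langle\pi(\tilde k,\tilde\kappa)\psi,\pi(\hat k,\hat\kappa)\psi\rangle\langle\pi(\hat k,\hat\kappa)\psi,\pi(k,\kappa)\psi\rangle=-\prod_{\ell=0}^s\zeta_{m_\ell}^{[k_\ell(\hat\kappa_\ell-\tilde\kappa_\ell)+\tilde k_\ell(\kappa_\ell-\hat\kappa_\ell)+\hat k_\ell(\tilde\kappa_\ell-\kappa_\ell)]/2}$$ $$=-\prod_{\ell=0}^s\zeta_{m_\ell}^{[(k_\ell\hat\kappa_\ell-\hat k_\ell\kappa_\ell)+(\tilde k_\ell\kappa_\ell-k_\ell\tilde\kappa_\ell)+(\hat k_\ell\tilde\kappa_\ell-\tilde k_\ell\hat\kappa_\ell)]/2},$$ where $1/2$ in the exponent denotes the inverse of $2$ modulo $m_\ell$.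
   Context: Inner products are linear in the first and conjugate-linear in the second argument. Elements of $G$ are ordered lexicographically and $\mathbb C^{|m|}$, $|m|=\prod_\ell m_\ell$, has standard basis $\{e_j\}_{j\in G}$. Fixed primitive $m_\ell$-th roots of unity $\zeta_{m_\ell}$; $T_m^{(k)}e_j=e_{j+k}$, $M_m^{(\kappa)}e_j=\prod_\ell\zeta_{m_\ell}^{\kappa_\ell j_\ell}e_j$. Let $c=((m_0-1)/2,\dots,(m_s-1)/2)$, $\mathcal I=\{i\in G:i<_{\mathrm{lex}}c\}$, $\phi_i=e_i-e_{ -i-\mathbb 1}$ where $-i-\mathbb 1=(m_0-i_0-1,\dots,m_s-i_s-1)$; $\psi\in\mathbb R^{|m|(|m|-1)/2}$ is the concatenation of the $\phi_i$, $i\in\mathcal I$, in lexicographic order, and $\pi(k,\kappa)=I_{(|m|-1)/2}\otimes(M_m^{(\kappa)}T_m^{(k)})$. -}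

module Defs where

open import Data.Nat as ℕ using (ℕ; zero; suc; _∸_; _<ᵇ_; _≡ᵇ_)
open import Data.Nat.DivMod using (_mod_; _/_)
open import Data.Fin as Fin using (Fin; toℕ; opposite)
open import Data.Fin.Properties using () renaming (_≟_ to _≟F_)
open import Data.Integer as ℤ using (ℤ; +_; -[1+_])
open import Data.List as List using (List; []; _∷_; map; concatMap; foldr; zipWith; filterᵇ)
open import Data.Bool using (Bool; true; false; if_then_else_; _∧_)
open import Data.Sum using (_⊎_)
open import Relation.Nullary using (¬_)
open import Relation.Nullary.Decidable using (⌊_⌋)
open import Relation.Binary.PropositionalEquality using (_≡_)
open import Data.Product using (_×_)
open import Algebra.Bundles using (CommutativeRing)
import Level

G : ∀ {n} → (Fin n → ℕ) → Set
G {n} m = (ℓ : Fin n) → Fin (m ℓ)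

_≈G_ : ∀ {n} {m : Fin n → ℕ} → G m → G m → Set
x ≈G y = ∀ ℓ → x ℓ ≡ y ℓ

DistinctPair : ∀ {n} {m : Fin n → ℕ} → G m → G m → G m → G m → Set
DistinctPair k κ k' κ' = ¬ (k ≈G k' × κ ≈G κ')

addF : ∀ {k} → Fin k → Fin k → Fin k
addF {suc k} a b = (toℕ a ℕ.+ toℕ b) mod suc k

negF : ∀ {k} → Fin k → Fin k
negF {suc k} a = (suc k ∸ toℕ a) mod suc k

addG : ∀ {n} {m : Fin n → ℕ} → G m → G m → G m
addG x y ℓ = addF (x ℓ) (y ℓ)

subG : ∀ {n} {m : Fin n → ℕ} → G m → G m → G m
subG x y ℓ = addF (x ℓ) (negF (y ℓ))

-- -i-𝟙 = (m_0 - i_0 - 1, …, m_s - i_s - 1)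
oppG : ∀ {n} {m : Fin n → ℕ} → G m → G m
oppG x ℓ = opposite (x ℓ)

eqGᵇ : ∀ {n} {m : Fin n → ℕ} → G m → G m → Bool
eqGᵇ {zero} x y = true
eqGᵇ {suc n} x y = ⌊ x Fin.zero ≟F y Fin.zero ⌋ ∧ eqGᵇ (λ ℓ → x (Fin.suc ℓ)) (λ ℓ → y (Fin.suc ℓ))

consG : ∀ {n} {m : Fin (suc n) → ℕ} → Fin (m Fin.zero) → G (λ ℓ → m (Fin.suc ℓ)) → G m
consG a g Fin.zero = a
consG a g (Fin.suc ℓ) = g ℓ

allG : ∀ {n} (m : Fin n → ℕ) → List (G m)
allG {zero} m = (λ ()) ∷ []
allG {suc n} m =
  concatMap (λ a → map (consG a) (allG (λ ℓ → m (Fin.suc ℓ)))) (List.allFin (m Fin.zero))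

ltLexᵇ : ∀ {n} → (Fin n → ℕ) → (Fin n → ℕ) → Bool
ltLexᵇ {zero} x y = false
ltLexᵇ {suc n} x y =
  if x Fin.zero <ᵇ y Fin.zero then true
  else if x Fin.zero ≡ᵇ y Fin.zero
       then ltLexᵇ (λ ℓ → x (Fin.suc ℓ)) (λ ℓ → y (Fin.suc ℓ))
       else false

cvec : ∀ {n} → (Fin n → ℕ) → (Fin n → ℕ)
cvec m ℓ = (m ℓ ∸ 1) / 2

indexI : ∀ {n} (m : Fin n → ℕ) → List (G m)
indexI m = filterᵇ (λ i → ltLexᵇ (λ ℓ → toℕ (i ℓ)) (cvec m)) (allG m)

module Ops {c ℓ'} (R : CommutativeRing c ℓ') (conj : CommutativeRing.Carrier R → CommutativeRing.Carrier R) where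
  open CommutativeRing R

  IsDomain : Set (c Level.⊔ ℓ')
  IsDomain = (¬ (1# ≈ 0#)) × (∀ x y → x * y ≈ 0# → (x ≈ 0#) ⊎ (y ≈ 0#))

  pow : Carrier → ℕ → Carrier
  pow x zero = 1#
  pow x (suc n) = x * pow x n

  record IsConjugation : Set (c Level.⊔ ℓ') where
    field
      cong-conj : ∀ {x y} → x ≈ y → conj x ≈ conj y
      conj-+ : ∀ x y → conj (x + y) ≈ conj x + conj y
      conj-* : ∀ x y → conj (x * y) ≈ conj x * conj y
      conj-1 : conj 1# ≈ 1#
      conj-invol : ∀ x → conj (conj x) ≈ x

  record IsPrimitiveRoot (ζ : Carrier) (m : ℕ) : Set (c Level.⊔ ℓ') where
    field
      root : pow ζ m ≈ 1#
      prim : ∀ a → 0 ℕ.< a → a ℕ.< m → ¬ (pow ζ a ≈ 1#)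
      conj-ζ : conj ζ ≈ pow ζ (m ∸ 1)

  -- integer powers of an m-th root of unity: ζ^(-(n+1)) = (ζ^(m-1))^(n+1)
  zpow : Carrier → ℕ → ℤ → Carrier
  zpow ζ m (+ n) = pow ζ n
  zpow ζ m -[1+ n ] = pow (pow ζ (m ∸ 1)) (suc n)

  prodF : ∀ {n} → (Fin n → Carrier) → Carrier
  prodF {zero} f = 1#
  prodF {suc n} f = f Fin.zero * prodF (λ ℓ → f (Fin.suc ℓ))

  sumL : List Carrier → Carrier
  sumL = foldr _+_ 0#

  VecG : ∀ {n} → (Fin n → ℕ) → Set c
  VecG m = G m → Carrier

  e : ∀ {n} {m : Fin n → ℕ} → G m → VecG m
  e j x = if eqGᵇ j x then 1# else 0#

  φ : ∀ {n} {m : Fin n → ℕ} → G m → VecG m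
  φ i x = e i x + - e (oppG i) x

  T : ∀ {n} {m : Fin n → ℕ} → G m → VecG m → VecG m
  T k v x = v (subG x k)

  M : ∀ {n} {m : Fin n → ℕ} → (Fin n → Carrier) → G m → VecG m → VecG m
  M ζ κ v x = prodF (λ ℓ → pow (ζ ℓ) (toℕ (κ ℓ) ℕ.* toℕ (x ℓ))) * v x

  -- ψ = concatenation of φ_i, i ∈ 𝓘, represented as the list of its blocks
  ψ : ∀ {n} (m : Fin n → ℕ) → List (VecG m)
  ψ m = map φ (indexI m)

  -- π(k,κ) = I ⊗ (M^{(κ)} T^{(k)}) acting blockwise
  π : ∀ {n} {m : Fin n → ℕ} → (Fin n → Carrier) → G m → G m → List (VecG m) → List (VecG m)
  π ζ k κ = map (λ v → M ζ κ (T k v))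

  inner : ∀ {n} (m : Fin n → ℕ) → VecG m → VecG m → Carrier
  inner m u v = sumL (map (λ j → u j * conj (v j)) (allG m))

  innerB : ∀ {n} (m : Fin n → ℕ) → List (VecG m) → List (VecG m) → Carrier
  innerB m U V = sumL (zipWith (inner m) U V)

  Gram : ∀ {n} (m : Fin n → ℕ) → (Fin n → Carrier) → G m → G m → G m → G m → Carrier
  Gram m ζ k κ k' κ' = innerB m (π ζ k κ (ψ m)) (π ζ k' κ' (ψ m))

private
  z : ∀ {k} → Fin k → ℤ
  z a = + toℕ a

expo₁ : ∀ {n} {m : Fin n → ℕ} → (k κ k̃ κ̃ k̂ κ̂ : G m) → Fin n → ℤ
expo₁ k κ k̃ κ̃ k̂ κ̂ ℓ =
  z (k ℓ) ℤ.* (z (κ̂ ℓ) ℤ.- z (κ̃ ℓ)) ℤ.+ z (k̃ ℓ) ℤ.* (z (κ ℓ) ℤ.- z (κ̂ ℓ))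
    ℤ.+ z (k̂ ℓ) ℤ.* (z (κ̃ ℓ) ℤ.- z (κ ℓ))

expo₂ : ∀ {n} {m : Fin n → ℕ} → (k κ k̃ κ̃ k̂ κ̂ : G m) → Fin n → ℤ
expo₂ k κ k̃ κ̃ k̂ κ̂ ℓ =
  (z (k ℓ) ℤ.* z (κ̂ ℓ) ℤ.- z (k̂ ℓ) ℤ.* z (κ ℓ))
    ℤ.+ (z (k̃ ℓ) ℤ.* z (κ ℓ) ℤ.- z (k ℓ) ℤ.* z (κ̃ ℓ))
    ℤ.+ (z (k̂ ℓ) ℤ.* z (κ̃ ℓ) ℤ.- z (k̃ ℓ) ℤ.* z (κ̂ ℓ))

-- As 𝓘 contains exactly one
-- of i, −i−𝟙 for every i other than the centre c, and φ_c = 0, we get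
-- Σ_{i∈𝓘} φ_i(a) φ_i(b) = φ_a(b).  A Gram entry is therefore a sum over x ∈ G of the character
-- ζ^{(κ−κ′)x} weighted by δ(x−k, x−k′) − δ(−(x−k)−𝟙, x−k′), and both terms factorise over the
-- coordinates.  For distinct pairs the first product vanishes (in some coordinate either
-- k_ℓ ≠ k′_ℓ, or κ_ℓ ≠ κ′_ℓ and a full sum of a nontrivial root of unity appears), while every
-- factor of the second has the single term x_ℓ = (k_ℓ + k′_ℓ − 1)/2.  Hence
-- ⟨π(k,κ)ψ, π(k′,κ′)ψ⟩ = −∏_ℓ ζ_ℓ^{(κ_ℓ−κ′_ℓ)(k_ℓ+k′_ℓ−1)/2}, and around the triangle the
-- −1/2 parts of the exponents cancel, leaving the alternating sum of the statement.

module Submission where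

open import Defs
open import Level using (Level)
open import Algebra.Bundles using (CommutativeRing)

module Congruence where
  open import Data.Nat using (ℕ; suc; _+_; _*_; _<_; NonZero)
  open import Data.Nat.Properties using (+-comm; +-identityʳ; +-cancelˡ-≡)
  open import Data.Nat.DivMod using (_%_; _/_; m≡m%n+[m/n]*n; [m+kn]%n≡m%n; m<n⇒m%n≡m)
  open import Data.Nat.Tactic.RingSolver using (solve)
  open import Data.List using (_∷_; [])
  open import Relation.Binary.PropositionalEquality
  open import Relation.Binary.Bundles using (Setoid)
  import Relation.Binary.Reasoning.Setoid as SetoidReasoning

  -- A record rather than a Σ-type, so that a, b and N are recovered by unification.
  infix 4 _≡_mod_
  record _≡_mod_ (a b N : ℕ) : Set where
    constructor mk≡mod
    field
      quotientˡ quotientʳ : ℕ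
      equation : a + quotientˡ * N ≡ b + quotientʳ * N

  module _ {N : ℕ} where
    open ≡-Reasoning

    ≡-mod-refl : ∀ {a} → a ≡ a mod N
    ≡-mod-refl = mk≡mod 0 0 refl

    ≡⇒≡-mod : ∀ {a b} → a ≡ b → a ≡ b mod N
    ≡⇒≡-mod refl = ≡-mod-refl

    ≡-mod-sym : ∀ {a b} → a ≡ b mod N → b ≡ a mod N
    ≡-mod-sym (mk≡mod p q eq) = mk≡mod q p (sym eq)

    ≡-mod-trans : ∀ {a b c} → a ≡ b mod N → b ≡ c mod N → a ≡ c mod N
    ≡-mod-trans {a} {b} {c} (mk≡mod p q eq₁) (mk≡mod r s eq₂) = mk≡mod (p + r) (s + q) (begin
      a + (p + r) * N      ≡⟨ solve (a ∷ p ∷ r ∷ N ∷ []) ⟩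
      (a + p * N) + r * N  ≡⟨ cong (_+ r * N) eq₁ ⟩
      (b + q * N) + r * N  ≡⟨ solve (b ∷ q ∷ r ∷ N ∷ []) ⟩
      (b + r * N) + q * N  ≡⟨ cong (_+ q * N) eq₂ ⟩
      (c + s * N) + q * N  ≡⟨ solve (c ∷ s ∷ q ∷ N ∷ []) ⟩
      c + (s + q) * N      ∎)

    +-cong-mod : ∀ {a b c d} → a ≡ b mod N → c ≡ d mod N → a + c ≡ b + d mod N
    +-cong-mod {a} {b} {c} {d} (mk≡mod p q eq₁) (mk≡mod r s eq₂) = mk≡mod (p + r) (q + s) (begin
      a + c + (p + r) * N        ≡⟨ solve (a ∷ c ∷ p ∷ r ∷ N ∷ []) ⟩
      (a + p * N) + (c + r * N)  ≡⟨ cong₂ _+_ eq₁ eq₂ ⟩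
      (b + q * N) + (d + s * N)  ≡⟨ solve (b ∷ d ∷ q ∷ s ∷ N ∷ []) ⟩
      b + d + (q + s) * N        ∎)

    +-congˡ-mod : ∀ c {a b} → a ≡ b mod N → c + a ≡ c + b mod N
    +-congˡ-mod c = +-cong-mod (≡-mod-refl {c})

    +-congʳ-mod : ∀ c {a b} → a ≡ b mod N → a + c ≡ b + c mod N
    +-congʳ-mod c eq = +-cong-mod eq (≡-mod-refl {c})

    *-congˡ-mod : ∀ c {a b} → a ≡ b mod N → c * a ≡ c * b mod N
    *-congˡ-mod c {a} {b} (mk≡mod p q eq) = mk≡mod (c * p) (c * q) (begin
      c * a + c * p * N  ≡⟨ solve (c ∷ a ∷ p ∷ N ∷ []) ⟩
      c * (a + p * N)    ≡⟨ cong (c *_) eq ⟩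
      c * (b + q * N)    ≡⟨ solve (c ∷ b ∷ q ∷ N ∷ []) ⟩
      c * b + c * q * N  ∎)

    +-*-≡-mod : ∀ a k → a + k * N ≡ a mod N
    +-*-≡-mod a k = mk≡mod 0 k (+-identityʳ _)

    +-cancelˡ-mod : ∀ c {a b} → c + a ≡ c + b mod N → a ≡ b mod N
    +-cancelˡ-mod c {a} {b} (mk≡mod p q eq) = mk≡mod p q (+-cancelˡ-≡ c _ _ (begin
      c + (a + p * N)  ≡⟨ solve (c ∷ a ∷ p ∷ N ∷ []) ⟩
      c + a + p * N    ≡⟨ eq ⟩
      c + b + q * N    ≡⟨ solve (c ∷ b ∷ q ∷ N ∷ []) ⟩
      c + (b + q * N)  ∎))

    module _ .{{_ : NonZero N}} where

      %-≡-mod : ∀ a → a % N ≡ a mod N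
      %-≡-mod a = mk≡mod (a / N) 0 (trans (sym (m≡m%n+[m/n]*n a N)) (sym (+-identityʳ a)))

      ≡-mod⇒%≡ : ∀ {a b} → a ≡ b mod N → a % N ≡ b % N
      ≡-mod⇒%≡ {a} {b} (mk≡mod p q eq) = begin
        a % N            ≡⟨ [m+kn]%n≡m%n a p N ⟨
        (a + p * N) % N  ≡⟨ cong (_% N) eq ⟩
        (b + q * N) % N  ≡⟨ [m+kn]%n≡m%n b q N ⟩
        b % N            ∎

      ≡-mod⇒≡ : ∀ {a b} → a ≡ b mod N → a < N → b < N → a ≡ b
      ≡-mod⇒≡ {a} {b} eq a<N b<N = begin
        a      ≡⟨ m<n⇒m%n≡m a<N ⟨
        a % N  ≡⟨ ≡-mod⇒%≡ eq ⟩
        b % N  ≡⟨ m<n⇒m%n≡m b<N ⟩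
        b      ∎

  +≡*⇒≡-mod : ∀ {n a c w} → a + c ≡ w * suc n → a ≡ n * c mod suc n
  +≡*⇒≡-mod {n} {a} {c} {w} a+c≡wN = mk≡mod c w (begin
    a + c * suc n      ≡⟨ solve (a ∷ c ∷ n ∷ []) ⟩
    (a + c) + n * c    ≡⟨ cong (_+ n * c) a+c≡wN ⟩
    w * suc n + n * c  ≡⟨ +-comm (w * suc n) (n * c) ⟩
    n * c + w * suc n  ∎)
    where open ≡-Reasoning

  ≡-mod-setoid : ℕ → Setoid _ _
  ≡-mod-setoid N = record
    { Carrier       = ℕ
    ; _≈_           = λ a b → a ≡ b mod N
    ; isEquivalence = record { refl = ≡-mod-refl ; sym = ≡-mod-sym ; trans = ≡-mod-trans }
    }

  module ≡-mod-Reasoning (N : ℕ) = SetoidReasoning (≡-mod-setoid N)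

  module _ {N : ℕ} (h q : ℕ) (2h≡1 : 2 * h ≡ 1 + q * N) where
    open ≡-mod-Reasoning N

    halve-mod : ∀ {t s} → t + t ≡ s mod N → t ≡ h * s mod N
    halve-mod {t} {s} 2t≡s = begin
      t                ≈⟨ ≡-mod-sym (+-*-≡-mod t (t * q)) ⟩
      t + t * q * N    ≡⟨ solve (t ∷ q ∷ N ∷ []) ⟩
      t * (1 + q * N)  ≡⟨ cong (t *_) 2h≡1 ⟨
      t * (2 * h)      ≡⟨ solve (t ∷ h ∷ []) ⟩
      h * (t + t)      ≈⟨ *-congˡ-mod h 2t≡s ⟩
      h * s            ∎

    double-mod : ∀ {t s} → t ≡ h * s mod N → t + t ≡ s mod N
    double-mod {t} {s} t≡hs = begin
      t + t            ≈⟨ +-cong-mod t≡hs t≡hs ⟩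
      h * s + h * s    ≡⟨ solve (h ∷ s ∷ []) ⟩
      (2 * h) * s      ≡⟨ cong (_* s) 2h≡1 ⟩
      (1 + q * N) * s  ≡⟨ solve (q ∷ N ∷ s ∷ []) ⟩
      s + q * s * N    ≈⟨ +-*-≡-mod s (q * s) ⟩
      s                ∎

module ResidueArithmetic where
  open import Data.Nat using (ℕ; suc; _+_; _*_; _∸_)
  open import Data.Nat.Properties using (+-assoc; +-comm; *-identityˡ; m∸n+n≡m; ≤-pred; <⇒≤; +-commutativeSemigroup)
  open import Data.Nat.DivMod using (m%n<n)
  open import Algebra.Properties.CommutativeSemigroup +-commutativeSemigroup using () renaming (interchange to +-interchange)
  open import Data.Nat.Tactic.RingSolver using (solve)
  open import Data.List using (_∷_; [])
  open import Data.Fin using (Fin; toℕ; opposite; fromℕ<)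
  open import Data.Fin.Properties using (toℕ-fromℕ<; toℕ<n; toℕ-injective; opposite-prop)
  open import Function.Bundles using (_⇔_; mk⇔; Equivalence)
  open import Relation.Binary.PropositionalEquality
  open import Defs using (addF; negF)
  open Congruence

  toℕ-opposite+toℕ : ∀ {N} (i : Fin N) → toℕ (opposite i) + toℕ i ≡ N ∸ 1
  toℕ-opposite+toℕ {suc n} i = trans (cong (_+ toℕ i) (opposite-prop i)) (m∸n+n≡m (≤-pred (toℕ<n i)))

  infixl 6 _⊖_
  _⊖_ : ∀ {N} → Fin N → Fin N → Fin N
  t ⊖ k = addF t (negF k)

  module _ {n : ℕ} where
    open ≡-mod-Reasoning (suc n)

    toℕ-injective-mod : {a b : Fin (suc n)} → toℕ a ≡ toℕ b mod suc n → a ≡ b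
    toℕ-injective-mod eq = toℕ-injective (≡-mod⇒≡ eq (toℕ<n _) (toℕ<n _))

    toℕ-fromℕ<-% : ∀ a → toℕ (fromℕ< (m%n<n a (suc n))) ≡ a mod suc n
    toℕ-fromℕ<-% a = ≡-mod-trans (≡⇒≡-mod (toℕ-fromℕ< _)) (%-≡-mod a)

    toℕ-⊖+toℕ : (t k : Fin (suc n)) → toℕ (t ⊖ k) + toℕ k ≡ toℕ t mod suc n
    toℕ-⊖+toℕ t k = begin
      toℕ (t ⊖ k) + toℕ k          ≈⟨ +-congʳ-mod (toℕ k) (toℕ-fromℕ<-% (toℕ t + toℕ (negF k))) ⟩
      toℕ t + toℕ (negF k) + toℕ k ≈⟨ +-congʳ-mod (toℕ k) (+-congˡ-mod (toℕ t) (toℕ-fromℕ<-% (suc n ∸ toℕ k))) ⟩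
      toℕ t + (suc n ∸ toℕ k) + toℕ k ≡⟨ +-assoc (toℕ t) _ _ ⟩
      toℕ t + (suc n ∸ toℕ k + toℕ k) ≡⟨ cong (toℕ t +_) (m∸n+n≡m (<⇒≤ (toℕ<n k))) ⟩
      toℕ t + suc n                ≡⟨ cong (toℕ t +_) (*-identityˡ (suc n)) ⟨
      toℕ t + 1 * suc n            ≈⟨ +-*-≡-mod (toℕ t) 1 ⟩
      toℕ t                        ∎

    x+n*y≡0⇒x≡y : (x y : Fin (suc n)) → toℕ x + n * toℕ y ≡ 0 mod suc n → x ≡ y
    x+n*y≡0⇒x≡y x y x+n*y≡0 = toℕ-injective-mod (begin
      toℕ x                        ≈⟨ +-*-≡-mod (toℕ x) (toℕ y) ⟨
      toℕ x + toℕ y * suc n        ≡⟨ a+b*[1+n]≡[a+n*b]+b (toℕ x) (toℕ y) ⟩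
      (toℕ x + n * toℕ y) + toℕ y  ≈⟨ +-congʳ-mod (toℕ y) x+n*y≡0 ⟩
      toℕ y                        ∎)
      where
      a+b*[1+n]≡[a+n*b]+b : ∀ a b → a + b * suc n ≡ (a + n * b) + b
      a+b*[1+n]≡[a+n*b]+b a b = solve (a ∷ b ∷ n ∷ [])

    ⊖-cancelˡ : (t k k′ : Fin (suc n)) → t ⊖ k ≡ t ⊖ k′ → k ≡ k′
    ⊖-cancelˡ t k k′ eq = toℕ-injective-mod (+-cancelˡ-mod (toℕ (t ⊖ k)) (begin
      toℕ (t ⊖ k) + toℕ k    ≈⟨ toℕ-⊖+toℕ t k ⟩
      toℕ t                  ≈⟨ toℕ-⊖+toℕ t k′ ⟨
      toℕ (t ⊖ k′) + toℕ k′  ≡⟨ cong (λ v → toℕ v + toℕ k′) eq ⟨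
      toℕ (t ⊖ k) + toℕ k′   ∎))

    opposite≡⇔+≡-mod : (u v : Fin (suc n)) → opposite u ≡ v ⇔ (toℕ u + toℕ v ≡ n mod suc n)
    opposite≡⇔+≡-mod u v = mk⇔
      (λ { refl → ≡⇒≡-mod u+opposite-u≡n })
      (λ u+v≡n → toℕ-injective-mod (+-cancelˡ-mod (toℕ u) (≡-mod-trans (≡⇒≡-mod u+opposite-u≡n) (≡-mod-sym u+v≡n))))
      where
      u+opposite-u≡n : toℕ u + toℕ (opposite u) ≡ n
      u+opposite-u≡n = trans (+-comm (toℕ u) _) (toℕ-opposite+toℕ u)

    module _ (h q : ℕ) (2h≡1 : 2 * h ≡ 1 + q * suc n) (k k′ : Fin (suc n)) where

      midpoint : Fin (suc n)
      midpoint = fromℕ< (m%n<n (h * (toℕ k + toℕ k′ + n)) (suc n))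

      private
        K = toℕ k + toℕ k′

        toℕ-midpoint : toℕ midpoint ≡ h * (K + n) mod suc n
        toℕ-midpoint = toℕ-fromℕ<-% (h * (K + n))

        ⊖-sum : ∀ t → toℕ (t ⊖ k) + toℕ (t ⊖ k′) + K ≡ toℕ t + toℕ t mod suc n
        ⊖-sum t = begin
          toℕ (t ⊖ k) + toℕ (t ⊖ k′) + (toℕ k + toℕ k′)   ≡⟨ +-interchange (toℕ (t ⊖ k)) _ _ _ ⟩
          (toℕ (t ⊖ k) + toℕ k) + (toℕ (t ⊖ k′) + toℕ k′) ≈⟨ +-cong-mod (toℕ-⊖+toℕ t k) (toℕ-⊖+toℕ t k′) ⟩
          toℕ t + toℕ t                                   ∎

      opposite-⊖≡⊖⇔≡midpoint : ∀ t → opposite (t ⊖ k) ≡ t ⊖ k′ ⇔ t ≡ midpoint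
      opposite-⊖≡⊖⇔≡midpoint t = mk⇔ to from
        where
        opposite⇔ = opposite≡⇔+≡-mod (t ⊖ k) (t ⊖ k′)

        to : opposite (t ⊖ k) ≡ t ⊖ k′ → t ≡ midpoint
        to opp≡ = toℕ-injective-mod (≡-mod-trans (halve-mod h q 2h≡1 (begin
          toℕ t + toℕ t                  ≈⟨ ⊖-sum t ⟨
          toℕ (t ⊖ k) + toℕ (t ⊖ k′) + K ≈⟨ +-congʳ-mod K (Equivalence.to opposite⇔ opp≡) ⟩
          n + K                          ≡⟨ +-comm n K ⟩
          K + n                          ∎)) (≡-mod-sym toℕ-midpoint))

        from : t ≡ midpoint → opposite (t ⊖ k) ≡ t ⊖ k′
        from t≡mid = Equivalence.from opposite⇔ (+-cancelˡ-mod K (begin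
          K + (toℕ (t ⊖ k) + toℕ (t ⊖ k′)) ≡⟨ +-comm K _ ⟩
          toℕ (t ⊖ k) + toℕ (t ⊖ k′) + K   ≈⟨ ⊖-sum t ⟩
          toℕ t + toℕ t                    ≈⟨ double-mod h q 2h≡1 (≡-mod-trans (≡⇒≡-mod (cong toℕ t≡mid)) toℕ-midpoint) ⟩
          K + n                            ∎))

module LexOrder where
  open import Data.Nat using (ℕ; zero; suc; _+_; _<_; _<ᵇ_; _≡ᵇ_; _≟_; _<?_)
  open import Data.Nat.Properties
  open import Data.Fin using (Fin) renaming (zero to fzero; suc to fsuc)
  open import Data.Bool using (true; false)
  open import Data.Unit using (tt)
  open import Relation.Binary.PropositionalEquality
  open import Relation.Binary.Definitions using (tri<; tri≈; tri>)
  open import Relation.Nullary using (¬_; yes; no)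
  open import Data.Empty using (⊥-elim)
  open import Function using (_∘_)
  open import Defs using (ltLexᵇ)

  private
    <ᵇ≡true : ∀ {m n} → m < n → (m <ᵇ n) ≡ true
    <ᵇ≡true {m} {n} m<n with m <ᵇ n | <⇒<ᵇ m<n
    ... | true | _ = refl

    <ᵇ≡false : ∀ {m n} → ¬ m < n → (m <ᵇ n) ≡ false
    <ᵇ≡false {m} {n} m≮n with m <ᵇ n | <ᵇ⇒< m n
    ... | true  | m<n = ⊥-elim (m≮n (m<n tt))
    ... | false | _   = refl

    ≡ᵇ≡true : ∀ {m n} → m ≡ n → (m ≡ᵇ n) ≡ true
    ≡ᵇ≡true {m} {n} m≡n with m ≡ᵇ n | ≡⇒≡ᵇ m n m≡n
    ... | true | _ = refl

    ≡ᵇ≡false : ∀ {m n} → ¬ m ≡ n → (m ≡ᵇ n) ≡ false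
    ≡ᵇ≡false {m} {n} m≢n with m ≡ᵇ n | ≡ᵇ⇒≡ m n
    ... | true  | m≡n = ⊥-elim (m≢n (m≡n tt))
    ... | false | _   = refl

    tail : ∀ {n} → (Fin (suc n) → ℕ) → Fin n → ℕ
    tail x ℓ = x (fsuc ℓ)

  module _ {n : ℕ} (x y : Fin (suc n) → ℕ) where

    ltLexᵇ-head< : x fzero < y fzero → ltLexᵇ x y ≡ true
    ltLexᵇ-head< x₀<y₀ rewrite <ᵇ≡true x₀<y₀ = refl

    ltLexᵇ-head> : y fzero < x fzero → ltLexᵇ x y ≡ false
    ltLexᵇ-head> y₀<x₀ rewrite <ᵇ≡false (<⇒≯ y₀<x₀) | ≡ᵇ≡false (>⇒≢ y₀<x₀) = refl

    ltLexᵇ-head≡ : x fzero ≡ y fzero → ltLexᵇ x y ≡ ltLexᵇ (tail x) (tail y)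
    ltLexᵇ-head≡ x₀≡y₀ rewrite <ᵇ≡false (≤⇒≯ (≤-reflexive (sym x₀≡y₀))) | ≡ᵇ≡true x₀≡y₀ = refl

  ltLexᵇ-asym : ∀ {n} (x y : Fin n → ℕ) → ltLexᵇ x y ≡ true → ltLexᵇ y x ≡ false
  ltLexᵇ-asym {zero} x y ()
  ltLexᵇ-asym {suc n} x y x<y with <-cmp (x fzero) (y fzero)
  ... | tri< x₀<y₀ _ _ = ltLexᵇ-head> y x x₀<y₀
  ... | tri≈ _ x₀≡y₀ _ = trans (ltLexᵇ-head≡ y x (sym x₀≡y₀))
                           (ltLexᵇ-asym (tail x) (tail y) (trans (sym (ltLexᵇ-head≡ x y x₀≡y₀)) x<y))
  ... | tri> _ _ y₀<x₀ with () ← trans (sym x<y) (ltLexᵇ-head> x y y₀<x₀)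

  ltLexᵇ-false-false⇒≗ : ∀ {n} (x y : Fin n → ℕ) → ltLexᵇ x y ≡ false → ltLexᵇ y x ≡ false → ∀ ℓ → x ℓ ≡ y ℓ
  ltLexᵇ-false-false⇒≗ {suc n} x y x≮y y≮x ℓ with <-cmp (x fzero) (y fzero)
  ... | tri< x₀<y₀ _ _ with () ← trans (sym (ltLexᵇ-head< x y x₀<y₀)) x≮y
  ... | tri> _ _ y₀<x₀ with () ← trans (sym (ltLexᵇ-head< y x y₀<x₀)) y≮x
  ... | tri≈ _ x₀≡y₀ _ with ℓ
  ...   | fzero  = x₀≡y₀
  ...   | fsuc ℓ = ltLexᵇ-false-false⇒≗ (tail x) (tail y)
                     (trans (sym (ltLexᵇ-head≡ x y x₀≡y₀)) x≮y)
                     (trans (sym (ltLexᵇ-head≡ y x (sym x₀≡y₀))) y≮x) ℓ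

  ltLexᵇ-cong : ∀ {n} {x x′ y y′ : Fin n → ℕ} → (∀ ℓ → x ℓ ≡ x′ ℓ) → (∀ ℓ → y ℓ ≡ y′ ℓ) →
                ltLexᵇ x y ≡ ltLexᵇ x′ y′
  ltLexᵇ-cong {zero} x≗x′ y≗y′ = refl
  ltLexᵇ-cong {suc n} {x} {x′} {y} {y′} x≗x′ y≗y′
    rewrite x≗x′ fzero | y≗y′ fzero
          | ltLexᵇ-cong {x = tail x} {tail x′} {tail y} {tail y′} (x≗x′ ∘ fsuc) (y≗y′ ∘ fsuc) = refl

  private
    <ᵇ-mirror : ∀ a b c → a + b ≡ c + c → (a <ᵇ c) ≡ (c <ᵇ b)
    <ᵇ-mirror a b c eq with a <? c | c <? b
    ... | yes a<c | yes c<b = trans (<ᵇ≡true a<c) (sym (<ᵇ≡true c<b))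
    ... | no  a≮c | no  c≮b = trans (<ᵇ≡false a≮c) (sym (<ᵇ≡false c≮b))
    ... | yes a<c | no  c≮b = ⊥-elim (<-irrefl eq (+-mono-<-≤ a<c (≮⇒≥ c≮b)))
    ... | no  a≮c | yes c<b = ⊥-elim (<-irrefl (sym eq) (+-mono-≤-< (≮⇒≥ a≮c) c<b))

    ≡ᵇ-mirror : ∀ a b c → a + b ≡ c + c → (a ≡ᵇ c) ≡ (c ≡ᵇ b)
    ≡ᵇ-mirror a b c eq with a ≟ c | c ≟ b
    ... | yes a≡c | yes c≡b = trans (≡ᵇ≡true a≡c) (sym (≡ᵇ≡true c≡b))
    ... | no  a≢c | no  c≢b = trans (≡ᵇ≡false a≢c) (sym (≡ᵇ≡false c≢b))
    ... | yes a≡c | no  c≢b = ⊥-elim (c≢b (sym (+-cancelˡ-≡ c b c (trans (cong (_+ b) (sym a≡c)) eq))))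
    ... | no  a≢c | yes c≡b = ⊥-elim (a≢c (+-cancelʳ-≡ b a c (trans eq (cong (c +_) c≡b))))

  ltLexᵇ-mirror : ∀ {n} (a b c : Fin n → ℕ) → (∀ ℓ → a ℓ + b ℓ ≡ c ℓ + c ℓ) → ltLexᵇ a c ≡ ltLexᵇ c b
  ltLexᵇ-mirror {zero} a b c eq = refl
  ltLexᵇ-mirror {suc n} a b c eq
    rewrite <ᵇ-mirror (a fzero) (b fzero) (c fzero) (eq fzero)
          | ≡ᵇ-mirror (a fzero) (b fzero) (c fzero) (eq fzero)
          | ltLexᵇ-mirror (tail a) (tail b) (tail c) (λ ℓ → eq (fsuc ℓ)) = refl

module GroupElements where
  open import Data.Nat using (ℕ; zero; suc)
  open import Data.Fin as Fin using (Fin; opposite)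
  open import Data.Fin.Properties using (_≟_; opposite-involutive)
  open import Data.Bool using (_∧_)
  open import Relation.Nullary.Decidable using (⌊_⌋)
  open import Relation.Binary.PropositionalEquality
  open import Defs

  module _ {n : ℕ} {m : Fin n → ℕ} where

    oppG-involutive : (x : G m) → oppG (oppG x) ≈G x
    oppG-involutive x ℓ = opposite-involutive (x ℓ)

    oppG-cong : {x y : G m} → x ≈G y → oppG x ≈G oppG y
    oppG-cong x≈y ℓ = cong opposite (x≈y ℓ)

  eqGᵇ-congˡ : ∀ {n} {m : Fin n → ℕ} {x y : G m} (z : G m) → x ≈G y → eqGᵇ x z ≡ eqGᵇ y z
  eqGᵇ-congˡ {zero}  z x≈y = refl
  eqGᵇ-congˡ {suc n} {m} {x} {y} z x≈y rewrite x≈y Fin.zero =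
    cong (⌊ y Fin.zero ≟ z Fin.zero ⌋ ∧_) (eqGᵇ-congˡ {m = λ ℓ → m (Fin.suc ℓ)} (λ ℓ → z (Fin.suc ℓ)) (λ ℓ → x≈y (Fin.suc ℓ)))

  module _ {n : ℕ} {m : Fin (suc n) → ℕ} where
    private
      m′ : Fin n → ℕ
      m′ ℓ = m (Fin.suc ℓ)

    consG-cong : ∀ (a : Fin (m Fin.zero)) {x y : G m′} → x ≈G y → consG {m = m} a x ≈G consG a y
    consG-cong a x≈y Fin.zero    = refl
    consG-cong a x≈y (Fin.suc ℓ) = x≈y ℓ

    consG-head-tail : ∀ (x : G m) → consG (x Fin.zero) (λ ℓ → x (Fin.suc ℓ)) ≈G x
    consG-head-tail x Fin.zero    = refl
    consG-head-tail x (Fin.suc ℓ) = refl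

    oppG-consG : ∀ a (g : G m′) → oppG (consG {m = m} a g) ≈G consG (opposite a) (oppG g)
    oppG-consG a g Fin.zero    = refl
    oppG-consG a g (Fin.suc ℓ) = refl

module IndexSet where
  open import Data.Nat using (ℕ; _+_; _*_; _∸_; _%_)
  open import Data.Nat.Properties using (+-identityʳ; *-comm; +-cancelʳ-≡)
  open import Data.Nat.DivMod using (_/_; m≡m%n+[m/n]*n; m*n/n≡m)
  open import Data.Fin using (Fin; toℕ; opposite)
  open import Data.Fin.Properties using (toℕ-injective)
  open import Data.Bool using (Bool; true; false)
  open import Relation.Binary.PropositionalEquality
  open import Defs
  open LexOrder
  open ResidueArithmetic using (toℕ-opposite+toℕ)

  [n∸1]/2+[n∸1]/2≡n∸1 : ∀ N → N % 2 ≡ 1 → (N ∸ 1) / 2 + (N ∸ 1) / 2 ≡ N ∸ 1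
  [n∸1]/2+[n∸1]/2≡n∸1 N odd = begin
    (N ∸ 1) / 2 + (N ∸ 1) / 2  ≡⟨ cong (λ v → v / 2 + v / 2) N∸1≡[N/2]*2 ⟩
    N / 2 * 2 / 2 + N / 2 * 2 / 2 ≡⟨ cong (λ v → v + v) (m*n/n≡m (N / 2) 2) ⟩
    N / 2 + N / 2              ≡⟨ cong (N / 2 +_) (+-identityʳ (N / 2)) ⟨
    2 * (N / 2)                ≡⟨ *-comm 2 (N / 2) ⟩
    N / 2 * 2                  ≡⟨ N∸1≡[N/2]*2 ⟨
    N ∸ 1                      ∎
    where
    open ≡-Reasoning
    N∸1≡[N/2]*2 : N ∸ 1 ≡ N / 2 * 2
    N∸1≡[N/2]*2 = cong (_∸ 1) (trans (m≡m%n+[m/n]*n N 2) (cong (_+ N / 2 * 2) odd))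

  module _ {n : ℕ} (m : Fin n → ℕ) where

    below above : G m → Bool
    below x = ltLexᵇ (λ ℓ → toℕ (x ℓ)) (cvec m)
    above x = ltLexᵇ (cvec m) (λ ℓ → toℕ (x ℓ))

    below-cong : {x y : G m} → x ≈G y → below x ≡ below y
    below-cong x≈y = ltLexᵇ-cong (λ ℓ → cong toℕ (x≈y ℓ)) (λ ℓ → refl)

    below⇒¬above : ∀ x → below x ≡ true → above x ≡ false
    below⇒¬above x = ltLexᵇ-asym (λ ℓ → toℕ (x ℓ)) (cvec m)

    module _ (odd : ∀ ℓ → m ℓ % 2 ≡ 1) where

      below-oppG : ∀ x → below (oppG x) ≡ above x
      below-oppG x = ltLexᵇ-mirror (λ ℓ → toℕ (opposite (x ℓ))) (λ ℓ → toℕ (x ℓ)) (cvec m)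
        (λ ℓ → trans (toℕ-opposite+toℕ (x ℓ)) (sym ([n∸1]/2+[n∸1]/2≡n∸1 (m ℓ) (odd ℓ))))

      ¬below-¬above⇒oppG-fixed : ∀ x → below x ≡ false → above x ≡ false → oppG x ≈G x
      ¬below-¬above⇒oppG-fixed x ¬below ¬above ℓ = toℕ-injective (+-cancelʳ-≡ (toℕ (x ℓ)) _ _ (begin
        toℕ (opposite (x ℓ)) + toℕ (x ℓ)  ≡⟨ toℕ-opposite+toℕ (x ℓ) ⟩
        m ℓ ∸ 1                            ≡⟨ [n∸1]/2+[n∸1]/2≡n∸1 (m ℓ) (odd ℓ) ⟨
        cvec m ℓ + cvec m ℓ                ≡⟨ cong₂ _+_ x≡c x≡c ⟨
        toℕ (x ℓ) + toℕ (x ℓ)              ∎))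
        where
        open ≡-Reasoning
        x≡c : toℕ (x ℓ) ≡ cvec m ℓ
        x≡c = ltLexᵇ-false-false⇒≗ (λ ℓ → toℕ (x ℓ)) (cvec m) ¬below ¬above ℓ

module PhaseArithmetic where
  open import Data.Nat as ℕ using (ℕ; suc)
  open import Data.Integer as ℤ using (ℤ; +_; -[1+_])
  open import Data.Integer.Properties using (pos-+; pos-*; +-injective)
  import Data.Nat.Tactic.RingSolver as ℕ-Solver
  import Data.Integer.Tactic.RingSolver as ℤ-Solver
  open import Relation.Binary.PropositionalEquality
  open import Data.Product using (∃; _,_)

  +-injectiveʳ : ∀ a c b → + a ≡ + c ℤ.+ + b → a ≡ c ℕ.+ b
  +-injectiveʳ a c b eq = +-injective (trans eq (sym (pos-+ c b)))

  -[1+]-injectiveʳ : ∀ a c b → + a ≡ -[1+ c ] ℤ.+ + b → a ℕ.+ suc c ≡ b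
  -[1+]-injectiveʳ a c b eq = +-injective (begin
    + (a ℕ.+ suc c)                  ≡⟨ pos-+ a (suc c) ⟩
    + a ℤ.+ + suc c                  ≡⟨ cong (ℤ._+ + suc c) eq ⟩
    ℤ.- + suc c ℤ.+ + b ℤ.+ + suc c  ≡⟨ [-x+y]+x≡y (+ suc c) (+ b) ⟩
    + b                              ∎)
    where
    open ≡-Reasoning
    [-x+y]+x≡y : ∀ (x y : ℤ) → ℤ.- x ℤ.+ y ℤ.+ x ≡ y
    [-x+y]+x≡y = ℤ-Solver.solve-∀

  -- (κ − κ′)·(k + k′ − 1)/2 modulo n + 1, with n standing for −1 and h for 1/2.
  phase : (n h k κ k′ κ′ : ℕ) → ℕ
  phase n h k κ k′ κ′ = (κ ℕ.+ n ℕ.* κ′) ℕ.* (h ℕ.* (k ℕ.+ k′ ℕ.+ n))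

  private
    x≡[x+y]-y : ∀ (x y : ℤ) → x ≡ (x ℤ.+ y) ℤ.+ ℤ.- y
    x≡[x+y]-y = ℤ-Solver.solve-∀

    [[y+z]+w]-y≡z+w : ∀ (y z w : ℤ) → ((y ℤ.+ z) ℤ.+ w) ℤ.+ ℤ.- y ≡ z ℤ.+ w
    [[y+z]+w]-y≡z+w = ℤ-Solver.solve-∀

    +-shiftʳ : ∀ a c A B (z : ℤ) → a ℕ.+ A ≡ B ℕ.+ c → + A ℤ.+ z ≡ + B → + a ≡ z ℤ.+ + c
    +-shiftʳ a c A B z a+A≡B+c A+z≡B = begin
      + a                              ≡⟨ x≡[x+y]-y (+ a) (+ A) ⟩
      (+ a ℤ.+ + A) ℤ.+ ℤ.- + A        ≡⟨ cong (ℤ._+ ℤ.- + A) (pos-+ a A) ⟨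
      + (a ℕ.+ A) ℤ.+ ℤ.- + A          ≡⟨ cong (λ v → + v ℤ.+ ℤ.- + A) a+A≡B+c ⟩
      + (B ℕ.+ c) ℤ.+ ℤ.- + A          ≡⟨ cong (ℤ._+ ℤ.- + A) (pos-+ B c) ⟩
      (+ B ℤ.+ + c) ℤ.+ ℤ.- + A        ≡⟨ cong (λ v → (v ℤ.+ + c) ℤ.+ ℤ.- + A) A+z≡B ⟨
      ((+ A ℤ.+ z) ℤ.+ + c) ℤ.+ ℤ.- + A ≡⟨ [[y+z]+w]-y≡z+w (+ A) z (+ c) ⟩
      z ℤ.+ + c                        ∎
      where open ≡-Reasoning

    cycleℕ : ∀ n h k κ k̃ κ̃ k̂ κ̂ →
      (κ ℕ.+ n ℕ.* κ̃) ℕ.* (h ℕ.* (k ℕ.+ k̃ ℕ.+ n)) ℕ.+ (κ̃ ℕ.+ n ℕ.* κ̂) ℕ.* (h ℕ.* (k̃ ℕ.+ k̂ ℕ.+ n))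
        ℕ.+ (κ̂ ℕ.+ n ℕ.* κ) ℕ.* (h ℕ.* (k̂ ℕ.+ k ℕ.+ n)) ℕ.+ h ℕ.* (k ℕ.* κ̃ ℕ.+ k̃ ℕ.* κ̂ ℕ.+ k̂ ℕ.* κ)
        ≡ h ℕ.* (k ℕ.* κ̂ ℕ.+ k̃ ℕ.* κ ℕ.+ k̂ ℕ.* κ̃)
          ℕ.+ (κ̃ ℕ.* (h ℕ.* (k ℕ.+ k̃ ℕ.+ n)) ℕ.+ κ̂ ℕ.* (h ℕ.* (k̃ ℕ.+ k̂ ℕ.+ n)) ℕ.+ κ ℕ.* (h ℕ.* (k̂ ℕ.+ k ℕ.+ n))) ℕ.* suc n
    cycleℕ = ℕ-Solver.solve-∀

    cycleℤ : ∀ (h k κ k̃ κ̃ k̂ κ̂ : ℤ) →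
      h ℤ.* (k ℤ.* κ̃ ℤ.+ k̃ ℤ.* κ̂ ℤ.+ k̂ ℤ.* κ) ℤ.+ h ℤ.* (k ℤ.* (κ̂ ℤ.- κ̃) ℤ.+ k̃ ℤ.* (κ ℤ.- κ̂) ℤ.+ k̂ ℤ.* (κ̃ ℤ.- κ))
        ≡ h ℤ.* (k ℤ.* κ̂ ℤ.+ k̃ ℤ.* κ ℤ.+ k̂ ℤ.* κ̃)
    cycleℤ = ℤ-Solver.solve-∀

    pos-*[*+*+*] : ∀ h a b c d e f →
      + (h ℕ.* (a ℕ.* b ℕ.+ c ℕ.* d ℕ.+ e ℕ.* f)) ≡ + h ℤ.* (+ a ℤ.* + b ℤ.+ + c ℤ.* + d ℤ.+ + e ℤ.* + f)
    pos-*[*+*+*] h a b c d e f = trans (pos-* h _) (cong (+ h ℤ.*_)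
      (trans (pos-+ (a ℕ.* b ℕ.+ c ℕ.* d) (e ℕ.* f))
        (cong₂ ℤ._+_ (trans (pos-+ (a ℕ.* b) (c ℕ.* d)) (cong₂ ℤ._+_ (pos-* a b) (pos-* c d))) (pos-* e f))))

  phase-cycle : ∀ n h k κ k̃ κ̃ k̂ κ̂ → ∃ λ w →
    + (phase n h k κ k̃ κ̃ ℕ.+ phase n h k̃ κ̃ k̂ κ̂ ℕ.+ phase n h k̂ κ̂ k κ)
      ≡ + h ℤ.* (+ k ℤ.* (+ κ̂ ℤ.- + κ̃) ℤ.+ + k̃ ℤ.* (+ κ ℤ.- + κ̂) ℤ.+ + k̂ ℤ.* (+ κ̃ ℤ.- + κ)) ℤ.+ + (w ℕ.* suc n)
  phase-cycle n h k κ k̃ κ̃ k̂ κ̂ = W , +-shiftʳ _ (W ℕ.* suc n) A B Z (cycleℕ n h k κ k̃ κ̃ k̂ κ̂) (begin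
    + A ℤ.+ Z                                                    ≡⟨ cong (ℤ._+ Z) (pos-*[*+*+*] h k κ̃ k̃ κ̂ k̂ κ) ⟩
    + h ℤ.* (+ k ℤ.* + κ̃ ℤ.+ + k̃ ℤ.* + κ̂ ℤ.+ + k̂ ℤ.* + κ) ℤ.+ Z ≡⟨ cycleℤ (+ h) (+ k) (+ κ) (+ k̃) (+ κ̃) (+ k̂) (+ κ̂) ⟩
    + h ℤ.* (+ k ℤ.* + κ̂ ℤ.+ + k̃ ℤ.* + κ ℤ.+ + k̂ ℤ.* + κ̃)       ≡⟨ pos-*[*+*+*] h k κ̂ k̃ κ k̂ κ̃ ⟨
    + B                                                          ∎)
    where
    open ≡-Reasoning
    A = h ℕ.* (k ℕ.* κ̃ ℕ.+ k̃ ℕ.* κ̂ ℕ.+ k̂ ℕ.* κ)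
    B = h ℕ.* (k ℕ.* κ̂ ℕ.+ k̃ ℕ.* κ ℕ.+ k̂ ℕ.* κ̃)
    W = κ̃ ℕ.* (h ℕ.* (k ℕ.+ k̃ ℕ.+ n)) ℕ.+ κ̂ ℕ.* (h ℕ.* (k̃ ℕ.+ k̂ ℕ.+ n)) ℕ.+ κ ℕ.* (h ℕ.* (k̂ ℕ.+ k ℕ.+ n))
    Z = + h ℤ.* (+ k ℤ.* (+ κ̂ ℤ.- + κ̃) ℤ.+ + k̃ ℤ.* (+ κ ℤ.- + κ̂) ℤ.+ + k̂ ℤ.* (+ κ̃ ℤ.- + κ))

  expo-alternating : ∀ (k κ k̃ κ̃ k̂ κ̂ : ℤ) →
    k ℤ.* (κ̂ ℤ.- κ̃) ℤ.+ k̃ ℤ.* (κ ℤ.- κ̂) ℤ.+ k̂ ℤ.* (κ̃ ℤ.- κ)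
      ≡ (k ℤ.* κ̂ ℤ.- k̂ ℤ.* κ) ℤ.+ (k̃ ℤ.* κ ℤ.- k ℤ.* κ̃) ℤ.+ (k̂ ℤ.* κ̃ ℤ.- k̃ ℤ.* κ̂)
  expo-alternating = ℤ-Solver.solve-∀

module Sums {a b : Level} (R : CommutativeRing a b) (conj : CommutativeRing.Carrier R → CommutativeRing.Carrier R) where
  open CommutativeRing R hiding (zero)
  open Ops R conj
  open import Algebra.Properties.Ring ring using (-0#≈0#; -‿+-comm; -1*x≈-x; -‿distribˡ-*; -‿distribʳ-*; -‿involutive)
  open import Algebra.Properties.CommutativeSemigroup +-commutativeSemigroup using () renaming (interchange to +-interchange)
  open import Algebra.Properties.CommutativeSemigroup *-commutativeSemigroup using () renaming (interchange to *-interchange)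
  open import Relation.Binary.Reasoning.Setoid setoid
  open import Data.Nat as ℕ using (ℕ; zero; suc)
  open import Data.Fin as Fin using (Fin; toℕ; opposite; inject₁; fromℕ)
  open import Data.Fin.Properties using (_≟_)
  open import Data.List as List using (List; []; _∷_; _++_; allFin)
  open import Data.List.Properties using (map-tabulate)
  open import Data.Nat.Properties using (*-zeroʳ; *-suc)
  open import Data.Bool using (Bool; true; false; _∧_; if_then_else_)
  open import Relation.Nullary.Decidable using (⌊_⌋; yes; no)
  open import Relation.Binary.Core using (_Preserves_⟶_)
  open import Relation.Nullary using (¬_)
  open import Data.Product using (_,_)
  open import Data.Sum using (inj₁; inj₂)
  open import Data.Empty using (⊥-elim)
  open import Algebra.Properties.Group +-group using (x∙y⁻¹≈ε⇒x≈y)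
  import Relation.Binary.PropositionalEquality as ≡
  open GroupElements

  -x*-y*-z≈-[x*y*z] : ∀ x y z → - x * - y * - z ≈ - (x * y * z)
  -x*-y*-z≈-[x*y*z] x y z = begin
    - x * - y * - z    ≈⟨ *-congʳ (trans (sym (-‿distribˡ-* x (- y))) (-‿cong (sym (-‿distribʳ-* x y)))) ⟩
    - - (x * y) * - z  ≈⟨ *-congʳ (-‿involutive (x * y)) ⟩
    x * y * - z        ≈⟨ -‿distribʳ-* (x * y) z ⟨
    - (x * y * z)      ∎

  𝟙 : Bool → Carrier
  𝟙 b = if b then 1# else 0#

  𝟙-∧ : ∀ p q → 𝟙 (p ∧ q) ≈ 𝟙 p * 𝟙 q
  𝟙-∧ true  q = sym (*-identityˡ (𝟙 q))
  𝟙-∧ false q = sym (zeroˡ (𝟙 q))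

  private variable
    i j : Level
    A : Set i
    B : Set j

  ∑ : List A → (A → Carrier) → Carrier
  ∑ xs f = sumL (List.map f xs)

  ∑-cong : ∀ xs {f g : A → Carrier} → (∀ x → f x ≈ g x) → ∑ xs f ≈ ∑ xs g
  ∑-cong []       f≈g = refl
  ∑-cong (x ∷ xs) f≈g = +-cong (f≈g x) (∑-cong xs f≈g)

  ∑-+ : ∀ xs (f g : A → Carrier) → ∑ xs (λ x → f x + g x) ≈ ∑ xs f + ∑ xs g
  ∑-+ []       f g = sym (+-identityˡ 0#)
  ∑-+ (x ∷ xs) f g = trans (+-congˡ (∑-+ xs f g)) (+-interchange (f x) (g x) (∑ xs f) (∑ xs g))

  ∑-*ˡ : ∀ xs c (f : A → Carrier) → ∑ xs (λ x → c * f x) ≈ c * ∑ xs f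
  ∑-*ˡ []       c f = sym (zeroʳ c)
  ∑-*ˡ (x ∷ xs) c f = trans (+-congˡ (∑-*ˡ xs c f)) (sym (distribˡ c (f x) (∑ xs f)))

  ∑-*ʳ : ∀ xs c (f : A → Carrier) → ∑ xs (λ x → f x * c) ≈ ∑ xs f * c
  ∑-*ʳ xs c f = trans (∑-cong xs (λ x → *-comm (f x) c)) (trans (∑-*ˡ xs c f) (*-comm c _))

  ∑-neg : ∀ xs (f : A → Carrier) → ∑ xs (λ x → - f x) ≈ - ∑ xs f
  ∑-neg []       f = sym -0#≈0#
  ∑-neg (x ∷ xs) f = trans (+-congˡ (∑-neg xs f)) (-‿+-comm (f x) (∑ xs f))

  ∑-zero : ∀ xs {f : A → Carrier} → (∀ x → f x ≈ 0#) → ∑ xs f ≈ 0#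
  ∑-zero []       f≈0 = refl
  ∑-zero (x ∷ xs) f≈0 = trans (+-cong (f≈0 x) (∑-zero xs f≈0)) (+-identityˡ 0#)

  ∑-++ : ∀ xs ys (f : A → Carrier) → ∑ (xs ++ ys) f ≈ ∑ xs f + ∑ ys f
  ∑-++ []       ys f = sym (+-identityˡ _)
  ∑-++ (x ∷ xs) ys f = trans (+-congˡ (∑-++ xs ys f)) (sym (+-assoc (f x) _ _))

  ∑-filterᵇ : ∀ (P : A → Bool) xs (f : A → Carrier) → ∑ (List.filterᵇ P xs) f ≈ ∑ xs (λ x → 𝟙 (P x) * f x)
  ∑-filterᵇ P []       f = refl
  ∑-filterᵇ P (x ∷ xs) f with P x
  ... | true  = +-cong (sym (*-identityˡ (f x))) (∑-filterᵇ P xs f)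
  ... | false = trans (sym (+-identityˡ _)) (+-cong (sym (zeroˡ (f x))) (∑-filterᵇ P xs f))

  ∑-map : ∀ xs (g : A → B) (f : B → Carrier) → ∑ (List.map g xs) f ≈ ∑ xs (λ x → f (g x))
  ∑-map []       g f = refl
  ∑-map (x ∷ xs) g f = +-congˡ (∑-map xs g f)

  ∑-concatMap : ∀ xs (g : A → List B) (f : B → Carrier) → ∑ (List.concatMap g xs) f ≈ ∑ xs (λ x → ∑ (g x) f)
  ∑-concatMap []       g f = refl
  ∑-concatMap (x ∷ xs) g f = trans (∑-++ (g x) (List.concatMap g xs) f) (+-congˡ (∑-concatMap xs g f))

  ∑-comm : ∀ xs (ys : List B) (f : A → B → Carrier) → ∑ xs (λ x → ∑ ys (f x)) ≈ ∑ ys (λ y → ∑ xs (λ x → f x y))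
  ∑-comm []       ys f = sym (∑-zero ys (λ _ → refl))
  ∑-comm (x ∷ xs) ys f = trans (+-congˡ (∑-comm xs ys f)) (sym (∑-+ ys (f x) _))

  ∑Fin : (n : ℕ) → (Fin n → Carrier) → Carrier
  ∑Fin n = ∑ (allFin n)

  ∑Fin-suc : ∀ n (f : Fin (suc n) → Carrier) → ∑Fin (suc n) f ≈ f Fin.zero + ∑Fin n (λ i → f (Fin.suc i))
  ∑Fin-suc n f = +-congˡ (begin
    ∑ (List.tabulate Fin.suc) f          ≡⟨ ≡.cong (λ xs → ∑ xs f) (map-tabulate (λ i → i) Fin.suc) ⟨
    ∑ (List.map Fin.suc (allFin n)) f    ≈⟨ ∑-map (allFin n) Fin.suc f ⟩
    ∑Fin n (λ i → f (Fin.suc i))         ∎)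

  ∑Fin-last : ∀ n (f : Fin (suc n) → Carrier) → ∑Fin (suc n) f ≈ ∑Fin n (λ i → f (inject₁ i)) + f (fromℕ n)
  ∑Fin-last zero    f = trans (∑Fin-suc zero f) (+-comm _ _)
  ∑Fin-last (suc n) f = begin
    ∑Fin (suc (suc n)) f                                                   ≈⟨ ∑Fin-suc (suc n) f ⟩
    f Fin.zero + ∑Fin (suc n) (λ i → f (Fin.suc i))                        ≈⟨ +-congˡ (∑Fin-last n (λ i → f (Fin.suc i))) ⟩
    f Fin.zero + (∑Fin n (λ i → f (Fin.suc (inject₁ i))) + f (fromℕ (suc n))) ≈⟨ +-assoc _ _ _ ⟨
    (f Fin.zero + ∑Fin n (λ i → f (Fin.suc (inject₁ i)))) + f (fromℕ (suc n)) ≈⟨ +-congʳ (∑Fin-suc n (λ i → f (inject₁ i))) ⟨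
    ∑Fin (suc n) (λ i → f (inject₁ i)) + f (fromℕ (suc n))                 ∎

  ∑Fin-opposite : ∀ n (f : Fin n → Carrier) → ∑Fin n (λ i → f (opposite i)) ≈ ∑Fin n f
  ∑Fin-opposite zero    f = refl
  ∑Fin-opposite (suc n) f = begin
    ∑Fin (suc n) (λ i → f (opposite i))                   ≈⟨ ∑Fin-suc n _ ⟩
    f (fromℕ n) + ∑Fin n (λ i → f (inject₁ (opposite i))) ≈⟨ +-congˡ (∑Fin-opposite n (λ i → f (inject₁ i))) ⟩
    f (fromℕ n) + ∑Fin n (λ i → f (inject₁ i))            ≈⟨ +-comm _ _ ⟩
    ∑Fin n (λ i → f (inject₁ i)) + f (fromℕ n)            ≈⟨ ∑Fin-last n f ⟨
    ∑Fin (suc n) f                                        ∎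

  ∑Fin-δ : ∀ n (c : Fin n) (f : Fin n → Carrier) → ∑Fin n (λ i → 𝟙 ⌊ i ≟ c ⌋ * f i) ≈ f c
  ∑Fin-δ (suc n) Fin.zero f = begin
    ∑Fin (suc n) _                                       ≈⟨ ∑Fin-suc n _ ⟩
    1# * f Fin.zero + ∑Fin n (λ i → 0# * f (Fin.suc i))  ≈⟨ +-cong (*-identityˡ _) (∑-zero (allFin n) (λ i → zeroˡ _)) ⟩
    f Fin.zero + 0#                                      ≈⟨ +-identityʳ _ ⟩
    f Fin.zero                                           ∎
  ∑Fin-δ (suc n) (Fin.suc c) f = begin
    ∑Fin (suc n) _
      ≈⟨ ∑Fin-suc n _ ⟩
    0# * f Fin.zero + ∑Fin n (λ i → 𝟙 ⌊ Fin.suc i ≟ Fin.suc c ⌋ * f (Fin.suc i))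
      ≈⟨ +-cong (zeroˡ _) (∑-cong (allFin n) (λ i → *-congʳ (reflexive (≡.cong 𝟙 (suc≟suc i))))) ⟩
    0# + ∑Fin n (λ i → 𝟙 ⌊ i ≟ c ⌋ * f (Fin.suc i))
      ≈⟨ +-identityˡ _ ⟩
    ∑Fin n (λ i → 𝟙 ⌊ i ≟ c ⌋ * f (Fin.suc i))
      ≈⟨ ∑Fin-δ n c (λ i → f (Fin.suc i)) ⟩
    f (Fin.suc c) ∎
    where
    suc≟suc : ∀ i → ⌊ Fin.suc i ≟ Fin.suc c ⌋ ≡.≡ ⌊ i ≟ c ⌋
    suc≟suc i with i ≟ c
    ... | yes _ = ≡.refl
    ... | no  _ = ≡.refl

  ∑Fin-geometric : ∀ n β → (β + - 1#) * ∑Fin n (λ i → pow β (toℕ i)) ≈ pow β n + - 1#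
  ∑Fin-geometric zero    β = trans (zeroʳ _) (sym (-‿inverseʳ 1#))
  ∑Fin-geometric (suc n) β = begin
    (β + - 1#) * ∑Fin (suc n) (λ i → pow β (toℕ i))   ≈⟨ *-congˡ (trans (∑Fin-suc n _) (+-congˡ (∑-*ˡ (allFin n) β _))) ⟩
    (β + - 1#) * (1# + β * S)                        ≈⟨ distribˡ _ _ _ ⟩
    (β + - 1#) * 1# + (β + - 1#) * (β * S)           ≈⟨ +-cong (*-identityʳ _) (x∙yz≈y∙xz _ _ _) ⟩
    (β + - 1#) + β * ((β + - 1#) * S)                ≈⟨ +-congˡ (*-congˡ (∑Fin-geometric n β)) ⟩
    (β + - 1#) + β * (pow β n + - 1#)                ≈⟨ +-congˡ (trans (distribˡ _ _ _) (+-congˡ (trans (*-comm β (- 1#)) (-1*x≈-x β)))) ⟩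
    (β + - 1#) + (β * pow β n + - β)                 ≈⟨ +-comm _ _ ⟩
    (β * pow β n + - β) + (β + - 1#)                 ≈⟨ +-assoc _ _ _ ⟩
    β * pow β n + (- β + (β + - 1#))                 ≈⟨ +-congˡ (trans (sym (+-assoc _ _ _)) (trans (+-congʳ (-‿inverseˡ β)) (+-identityˡ _))) ⟩
    β * pow β n + - 1#                               ∎
    where
    S = ∑Fin n (λ i → pow β (toℕ i))
    open import Algebra.Properties.CommutativeSemigroup *-commutativeSemigroup using (x∙yz≈y∙xz)

  ∑Fin-pow≈0 : IsDomain → ∀ N β → pow β N ≈ 1# → ¬ β ≈ 1# → ∑Fin N (λ i → pow β (toℕ i)) ≈ 0#
  ∑Fin-pow≈0 (_ , no-zero-divisors) N β βᴺ≈1 β≉1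
    with no-zero-divisors (β + - 1#) _ (trans (∑Fin-geometric N β) (trans (+-congʳ βᴺ≈1) (-‿inverseʳ 1#)))
  ... | inj₁ β-1≈0 = ⊥-elim (β≉1 (x∙y⁻¹≈ε⇒x≈y β 1# β-1≈0))
  ... | inj₂ ∑≈0   = ∑≈0

  ∑G : ∀ {n} (m : Fin n → ℕ) → (G m → Carrier) → Carrier
  ∑G m = ∑ (allG m)

  ∑G-cons : ∀ {n} (m : Fin (suc n) → ℕ) (f : G m → Carrier) →
            ∑G m f ≈ ∑Fin (m Fin.zero) (λ a → ∑G (λ ℓ → m (Fin.suc ℓ)) (λ g → f (consG a g)))
  ∑G-cons m f = trans (∑-concatMap (allFin (m Fin.zero)) _ f)
                      (∑-cong (allFin (m Fin.zero)) (λ a → ∑-map (allG _) (consG a) f))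

  ∑G-prod : ∀ {n} (m : Fin n → ℕ) (f : (ℓ : Fin n) → Fin (m ℓ) → Carrier) →
            ∑G m (λ x → prodF (λ ℓ → f ℓ (x ℓ))) ≈ prodF (λ ℓ → ∑Fin (m ℓ) (f ℓ))
  ∑G-prod {zero}  m f = +-identityʳ 1#
  ∑G-prod {suc n} m f = begin
    ∑G m (λ x → prodF (λ ℓ → f ℓ (x ℓ)))
      ≈⟨ ∑G-cons m _ ⟩
    ∑Fin (m Fin.zero) (λ a → ∑G m′ (λ g → f Fin.zero a * P g))
      ≈⟨ ∑-cong (allFin (m Fin.zero)) (λ a → trans (∑-*ˡ (allG m′) (f Fin.zero a) P) (*-congˡ (∑G-prod m′ f′))) ⟩
    ∑Fin (m Fin.zero) (λ a → f Fin.zero a * prodF (λ ℓ → ∑Fin (m′ ℓ) (f′ ℓ)))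
      ≈⟨ ∑-*ʳ (allFin (m Fin.zero)) _ (f Fin.zero) ⟩
    ∑Fin (m Fin.zero) (f Fin.zero) * prodF (λ ℓ → ∑Fin (m′ ℓ) (f′ ℓ)) ∎
    where
    m′ = λ ℓ → m (Fin.suc ℓ)
    f′ = λ ℓ → f (Fin.suc ℓ)
    P  = λ (g : G m′) → prodF (λ ℓ → f′ ℓ (g ℓ))

  ∑G-oppG : ∀ {n} (m : Fin n → ℕ) (f : G m → Carrier) → f Preserves _≈G_ ⟶ _≈_ →
            ∑G m (λ x → f (oppG x)) ≈ ∑G m f
  ∑G-oppG {zero}  m f f-cong = +-congʳ (f-cong (λ ()))
  ∑G-oppG {suc n} m f f-cong = begin
    ∑G m (λ x → f (oppG x))
      ≈⟨ ∑G-cons m _ ⟩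
    ∑Fin (m Fin.zero) (λ a → ∑G m′ (λ g → f (oppG (consG a g))))
      ≈⟨ ∑-cong (allFin (m Fin.zero)) (λ a → ∑-cong (allG m′) (λ g → f-cong (oppG-consG a g))) ⟩
    ∑Fin (m Fin.zero) (λ a → ∑G m′ (λ g → f (consG (opposite a) (oppG g))))
      ≈⟨ ∑-cong (allFin (m Fin.zero)) (λ a → ∑G-oppG m′ _ (λ x≈y → f-cong (consG-cong (opposite a) x≈y))) ⟩
    ∑Fin (m Fin.zero) (λ a → F (opposite a))
      ≈⟨ ∑Fin-opposite (m Fin.zero) F ⟩
    ∑Fin (m Fin.zero) F
      ≈⟨ ∑G-cons m f ⟨
    ∑G m f ∎
    where
    m′ = λ ℓ → m (Fin.suc ℓ)
    F  = λ a → ∑G m′ (λ g → f (consG a g))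

  ∑G-δ : ∀ {n} (m : Fin n → ℕ) (f : G m → Carrier) → f Preserves _≈G_ ⟶ _≈_ → (c : G m) →
         ∑G m (λ x → 𝟙 (eqGᵇ x c) * f x) ≈ f c
  ∑G-δ {zero}  m f f-cong c = trans (+-identityʳ _) (trans (*-identityˡ _) (f-cong (λ ())))
  ∑G-δ {suc n} m f f-cong c = begin
    ∑G m (λ x → 𝟙 (eqGᵇ x c) * f x)
      ≈⟨ ∑G-cons m _ ⟩
    ∑Fin (m Fin.zero) (λ a → ∑G m′ (λ y → 𝟙 (⌊ a ≟ c Fin.zero ⌋ ∧ eqGᵇ y c′) * f (consG a y)))
      ≈⟨ ∑-cong (allFin (m Fin.zero)) (λ a → ∑-cong (allG m′) (λ y → trans (*-congʳ (𝟙-∧ ⌊ a ≟ c Fin.zero ⌋ (eqGᵇ y c′))) (*-assoc _ _ _))) ⟩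
    ∑Fin (m Fin.zero) (λ a → ∑G m′ (λ y → 𝟙 ⌊ a ≟ c Fin.zero ⌋ * (𝟙 (eqGᵇ y c′) * f (consG a y))))
      ≈⟨ ∑-cong (allFin (m Fin.zero)) (λ a → ∑-*ˡ (allG m′) _ _) ⟩
    ∑Fin (m Fin.zero) (λ a → 𝟙 ⌊ a ≟ c Fin.zero ⌋ * ∑G m′ (λ y → 𝟙 (eqGᵇ y c′) * f (consG a y)))
      ≈⟨ ∑-cong (allFin (m Fin.zero)) (λ a → *-congˡ (∑G-δ m′ _ (λ x≈y → f-cong (consG-cong a x≈y)) c′)) ⟩
    ∑Fin (m Fin.zero) (λ a → 𝟙 ⌊ a ≟ c Fin.zero ⌋ * f (consG a c′))
      ≈⟨ ∑Fin-δ (m Fin.zero) (c Fin.zero) _ ⟩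
    f (consG (c Fin.zero) c′)
      ≈⟨ f-cong (consG-head-tail c) ⟩
    f c ∎
    where
    m′ = λ ℓ → m (Fin.suc ℓ)
    c′ = λ ℓ → c (Fin.suc ℓ)

  prodF-cong : ∀ {n} {f g : Fin n → Carrier} → (∀ ℓ → f ℓ ≈ g ℓ) → prodF f ≈ prodF g
  prodF-cong {zero}  f≈g = refl
  prodF-cong {suc n} f≈g = *-cong (f≈g Fin.zero) (prodF-cong (λ ℓ → f≈g (Fin.suc ℓ)))

  prodF-* : ∀ {n} (f g : Fin n → Carrier) → prodF f * prodF g ≈ prodF (λ ℓ → f ℓ * g ℓ)
  prodF-* {zero}  f g = *-identityˡ 1#
  prodF-* {suc n} f g = trans (*-interchange _ _ _ _) (*-congˡ (prodF-* (λ ℓ → f (Fin.suc ℓ)) (λ ℓ → g (Fin.suc ℓ))))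

  prodF-*₃ : ∀ {n} (f g k : Fin n → Carrier) → prodF f * prodF g * prodF k ≈ prodF (λ ℓ → f ℓ * g ℓ * k ℓ)
  prodF-*₃ f g k = trans (*-congʳ (prodF-* f g)) (prodF-* (λ ℓ → f ℓ * g ℓ) k)

  prodF-zero : ∀ {n} (f : Fin n → Carrier) (ℓ : Fin n) → f ℓ ≈ 0# → prodF f ≈ 0#
  prodF-zero f Fin.zero    fℓ≈0 = trans (*-congʳ fℓ≈0) (zeroˡ _)
  prodF-zero f (Fin.suc ℓ) fℓ≈0 = trans (*-congˡ (prodF-zero (λ ℓ → f (Fin.suc ℓ)) ℓ fℓ≈0)) (zeroʳ _)

  𝟙-eqGᵇ : ∀ {n} {m : Fin n → ℕ} (u v : G m) → 𝟙 (eqGᵇ u v) ≈ prodF (λ ℓ → 𝟙 ⌊ u ℓ ≟ v ℓ ⌋)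
  𝟙-eqGᵇ {zero}  u v = refl
  𝟙-eqGᵇ {suc n} u v = trans (𝟙-∧ _ _) (*-congˡ (𝟙-eqGᵇ (λ ℓ → u (Fin.suc ℓ)) (λ ℓ → v (Fin.suc ℓ))))

  pow-cong : ∀ {x y} n → x ≈ y → pow x n ≈ pow y n
  pow-cong zero    x≈y = refl
  pow-cong (suc n) x≈y = *-cong x≈y (pow-cong n x≈y)

  pow-+ : ∀ x p q → pow x (p ℕ.+ q) ≈ pow x p * pow x q
  pow-+ x zero    q = sym (*-identityˡ _)
  pow-+ x (suc p) q = trans (*-congˡ (pow-+ x p q)) (sym (*-assoc _ _ _))

  pow-* : ∀ x p q → pow (pow x p) q ≈ pow x (p ℕ.* q)
  pow-* x p zero    = reflexive (≡.cong (pow x) (≡.sym (*-zeroʳ p)))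
  pow-* x p (suc q) = begin
    pow x p * pow (pow x p) q  ≈⟨ *-congˡ (pow-* x p q) ⟩
    pow x p * pow x (p ℕ.* q)  ≈⟨ pow-+ x p (p ℕ.* q) ⟨
    pow x (p ℕ.+ p ℕ.* q)      ≡⟨ ≡.cong (pow x) (*-suc p q) ⟨
    pow x (p ℕ.* suc q)        ∎

  pow-1# : ∀ n → pow 1# n ≈ 1#
  pow-1# zero    = refl
  pow-1# (suc n) = trans (*-identityˡ _) (pow-1# n)

module Frame {a b : Level} (R : CommutativeRing a b) (conj : CommutativeRing.Carrier R → CommutativeRing.Carrier R) where
  open CommutativeRing R hiding (zero)
  open Ops R conj
  open Sums R conj
  open GroupElements
  open IndexSet
  open import Algebra.Properties.Ring ring using (-‿involutive; -‿+-comm; -‿distribˡ-*; -‿distribʳ-*)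
  open import Relation.Binary.Reasoning.Setoid setoid
  open import Data.Nat using (ℕ; _%_)
  open import Data.Fin using (Fin)
  open import Data.Bool using (true; false)
  open import Function using (_∘_)
  import Relation.Binary.PropositionalEquality as ≡

  module _ {n : ℕ} {m : Fin n → ℕ} where

    e-congˡ : {x y : G m} (z : G m) → x ≈G y → e x z ≈ e y z
    e-congˡ z x≈y = reflexive (≡.cong 𝟙 (eqGᵇ-congˡ z x≈y))

    φ-congˡ : {x y : G m} (z : G m) → x ≈G y → φ x z ≈ φ y z
    φ-congˡ z x≈y = +-cong (e-congˡ z x≈y) (-‿cong (e-congˡ z (oppG-cong x≈y)))

    φ-oppG : (i z : G m) → φ (oppG i) z ≈ - φ i z
    φ-oppG i z = begin
      e (oppG i) z + - e (oppG (oppG i)) z ≈⟨ +-congˡ (-‿cong (e-congˡ z (oppG-involutive i))) ⟩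
      e (oppG i) z + - e i z               ≈⟨ +-comm _ _ ⟩
      - e i z + e (oppG i) z               ≈⟨ +-congˡ (-‿involutive _) ⟨
      - e i z + - - e (oppG i) z           ≈⟨ -‿+-comm _ _ ⟩
      - (e i z + - e (oppG i) z)           ∎

    φ-fixed : (i z : G m) → oppG i ≈G i → φ i z ≈ 0#
    φ-fixed i z fixed = trans (+-congˡ (-‿cong (e-congˡ z fixed))) (-‿inverseʳ _)

    φ*φ≈ : (a b i : G m) → φ i a * φ i b ≈ e i a * φ i b + e (oppG i) a * φ (oppG i) b
    φ*φ≈ a b i = begin
      (e i a + - e (oppG i) a) * φ i b          ≈⟨ distribʳ _ _ _ ⟩
      e i a * φ i b + - e (oppG i) a * φ i b    ≈⟨ +-congˡ (-‿distribˡ-* _ _) ⟨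
      e i a * φ i b + - (e (oppG i) a * φ i b)  ≈⟨ +-congˡ (-‿distribʳ-* _ _) ⟩
      e i a * φ i b + e (oppG i) a * - φ i b    ≈⟨ +-congˡ (*-congˡ (φ-oppG i b)) ⟨
      e i a * φ i b + e (oppG i) a * φ (oppG i) b ∎

  φ-resolution : ∀ {n} (m : Fin n → ℕ) → (∀ ℓ → m ℓ % 2 ≡.≡ 1) →
                 (a b : G m) → ∑ (indexI m) (λ i → φ i a * φ i b) ≈ φ a b
  φ-resolution m odd a b = begin
    ∑ I (λ i → φ i a * φ i b)
      ≈⟨ ∑-cong I (φ*φ≈ a b) ⟩
    ∑ I (λ i → τ i + τ (oppG i))
      ≈⟨ ∑-+ I τ (τ ∘ oppG) ⟩
    ∑ I τ + ∑ I (τ ∘ oppG)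
      ≈⟨ +-cong (∑-filterᵇ (below m) (allG m) τ) (∑-filterᵇ (below m) (allG m) (τ ∘ oppG)) ⟩
    ∑G m (λ x → 𝟙 (below m x) * τ x) + ∑G m τ⁻
      ≈⟨ +-congˡ (∑G-oppG m τ⁻ τ⁻-cong) ⟨
    ∑G m (λ x → 𝟙 (below m x) * τ x) + ∑G m (τ⁻ ∘ oppG)
      ≈⟨ +-congˡ (∑-cong (allG m) (λ x → *-cong (reflexive (≡.cong 𝟙 (below-oppG m odd x))) (τ-cong (oppG-involutive x)))) ⟩
    ∑G m (λ x → 𝟙 (below m x) * τ x) + ∑G m (λ x → 𝟙 (above m x) * τ x)
      ≈⟨ ∑-+ (allG m) _ _ ⟨
    ∑G m (λ x → 𝟙 (below m x) * τ x + 𝟙 (above m x) * τ x)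
      ≈⟨ ∑-cong (allG m) below-or-above ⟩
    ∑G m τ
      ≈⟨ ∑G-δ m (λ i → φ i b) (λ x≈y → φ-congˡ b x≈y) a ⟩
    φ a b ∎
    where
    I = indexI m

    τ : G m → Carrier
    τ i = e i a * φ i b

    τ-cong : {x y : G m} → x ≈G y → τ x ≈ τ y
    τ-cong x≈y = *-cong (e-congˡ a x≈y) (φ-congˡ b x≈y)

    τ⁻ : G m → Carrier
    τ⁻ x = 𝟙 (below m x) * τ (oppG x)

    τ⁻-cong : {x y : G m} → x ≈G y → τ⁻ x ≈ τ⁻ y
    τ⁻-cong x≈y = *-cong (reflexive (≡.cong 𝟙 (below-cong m x≈y))) (τ-cong (oppG-cong x≈y))

    below-or-above : ∀ x → 𝟙 (below m x) * τ x + 𝟙 (above m x) * τ x ≈ τ x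
    below-or-above x with below m x in below≡ | above m x in above≡
    ... | true  | true  with () ← ≡.trans (≡.sym above≡) (below⇒¬above m x below≡)
    ... | true  | false = trans (+-cong (*-identityˡ _) (zeroˡ _)) (+-identityʳ _)
    ... | false | true  = trans (+-cong (zeroˡ _) (*-identityˡ _)) (+-identityˡ _)
    ... | false | false = trans (+-cong (zeroˡ _) (zeroˡ _)) (trans (+-identityˡ 0#)
                            (sym (trans (*-congˡ (φ-fixed x b (¬below-¬above⇒oppG-fixed m odd x below≡ above≡))) (zeroʳ _))))

module GramEntries {a b : Level} (R : CommutativeRing a b) (conj : CommutativeRing.Carrier R → CommutativeRing.Carrier R)
                   (isConj : Ops.IsConjugation R conj) where
  open CommutativeRing R hiding (zero)
  open Ops R conj
  open IsConjugation isConj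
  open Sums R conj
  open Frame R conj
  open ResidueArithmetic using (_⊖_; ⊖-cancelˡ; toℕ-fromℕ<-%; x+n*y≡0⇒x≡y; midpoint; opposite-⊖≡⊖⇔≡midpoint)
  open Congruence
  open PhaseArithmetic
  open import Algebra.Properties.Ring ring using (x+x≈x⇒x≈0; +-inverseˡ-unique; -‿distribʳ-*)
  open import Algebra.Properties.CommutativeSemigroup *-commutativeSemigroup using () renaming (interchange to *-interchange)
  open import Relation.Binary.Reasoning.Setoid setoid
  open import Data.Nat as ℕ using (ℕ; _%_; _<_; z≤n; s≤s)
  open import Data.Nat.DivMod using (m%n<n)
  import Data.Nat.Properties as ℕₚ
  open import Data.Integer as ℤ using (+_; -[1+_])
  open import Data.Fin as Fin using (Fin; toℕ; opposite)
  open import Data.Fin.Properties using (_≟_; ¬∀⟶∃¬)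
  open import Data.List as List using (List; []; _∷_)
  open import Data.Bool using (true; false)
  open import Data.Product using (_×_; _,_; proj₁; proj₂; ∃)
  open import Data.Empty using (⊥-elim)
  open import Relation.Nullary using (¬_; yes; no)
  open import Relation.Nullary.Decidable using (⌊_⌋; does-⇔; isYes≗does; _×-dec_)
  import Relation.Binary.PropositionalEquality as ≡

  conj-0# : conj 0# ≈ 0#
  conj-0# = x+x≈x⇒x≈0 (conj 0#) (trans (sym (conj-+ 0# 0#)) (cong-conj (+-identityˡ 0#)))

  conj-neg : ∀ x → conj (- x) ≈ - conj x
  conj-neg x = +-inverseˡ-unique (conj (- x)) (conj x) (trans (sym (conj-+ (- x) x)) (trans (cong-conj (-‿inverseˡ x)) conj-0#))

  conj-𝟙 : ∀ p → conj (𝟙 p) ≈ 𝟙 p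
  conj-𝟙 true  = conj-1
  conj-𝟙 false = conj-0#

  conj-φ : ∀ {n} {m : Fin n → ℕ} (i x : G m) → conj (φ i x) ≈ φ i x
  conj-φ i x = trans (conj-+ _ _) (+-cong (conj-𝟙 _) (trans (conj-neg _) (-‿cong (conj-𝟙 _))))

  conj-prodF : ∀ {n} (f : Fin n → Carrier) → conj (prodF f) ≈ prodF (λ ℓ → conj (f ℓ))
  conj-prodF {ℕ.zero}  f = conj-1
  conj-prodF {ℕ.suc n} f = trans (conj-* _ _) (*-congˡ (conj-prodF (λ ℓ → f (Fin.suc ℓ))))

  conj-pow : ∀ x q → conj (pow x q) ≈ pow (conj x) q
  conj-pow x ℕ.zero    = conj-1
  conj-pow x (ℕ.suc q) = trans (conj-* _ _) (*-congˡ (conj-pow x q))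

  χ : ∀ {n} {m : Fin n → ℕ} → (Fin n → Carrier) → G m → G m → Carrier
  χ ζ κ x = prodF (λ ℓ → pow (ζ ℓ) (toℕ (κ ℓ) ℕ.* toℕ (x ℓ)))

  private
    ∑-zipWith-map : ∀ {i} {A : Set i} (g : A → A → Carrier) (f f′ : A → A) (xs : List A) →
                    sumL (List.zipWith g (List.map f xs) (List.map f′ xs)) ≈ ∑ xs (λ v → g (f v) (f′ v))
    ∑-zipWith-map g f f′ []       = refl
    ∑-zipWith-map g f f′ (x ∷ xs) = +-congˡ (∑-zipWith-map g f f′ xs)

  Gram≈∑G : ∀ {n} (m : Fin n → ℕ) → (∀ ℓ → m ℓ % 2 ≡.≡ 1) → (ζ : Fin n → Carrier) (k κ k′ κ′ : G m) →
            Gram m ζ k κ k′ κ′ ≈ ∑G m (λ x → (χ ζ κ x * conj (χ ζ κ′ x)) * φ (subG x k) (subG x k′))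
  Gram≈∑G m odd ζ k κ k′ κ′ = begin
    Gram m ζ k κ k′ κ′
      ≈⟨ ∑-zipWith-map (inner m) _ _ (List.map φ I) ⟩
    ∑ (List.map φ I) (λ v → inner m (M ζ κ (T k v)) (M ζ κ′ (T k′ v)))
      ≈⟨ ∑-map I φ _ ⟩
    ∑ I (λ i → ∑G m (λ x → (χ ζ κ x * φ i (x-k x)) * conj (χ ζ κ′ x * φ i (x-k′ x))))
      ≈⟨ ∑-cong I (λ i → ∑-cong (allG m) (λ x → conj-twisted i x)) ⟩
    ∑ I (λ i → ∑G m (λ x → w x * (φ i (x-k x) * φ i (x-k′ x))))
      ≈⟨ ∑-comm I (allG m) _ ⟩
    ∑G m (λ x → ∑ I (λ i → w x * (φ i (x-k x) * φ i (x-k′ x))))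
      ≈⟨ ∑-cong (allG m) (λ x → ∑-*ˡ I (w x) _) ⟩
    ∑G m (λ x → w x * ∑ I (λ i → φ i (x-k x) * φ i (x-k′ x)))
      ≈⟨ ∑-cong (allG m) (λ x → *-congˡ (φ-resolution m odd (x-k x) (x-k′ x))) ⟩
    ∑G m (λ x → w x * φ (x-k x) (x-k′ x)) ∎
    where
    I = indexI m
    x-k = λ x → subG x k
    x-k′ = λ x → subG x k′
    w = λ x → χ ζ κ x * conj (χ ζ κ′ x)
    conj-twisted : ∀ i x → (χ ζ κ x * φ i (x-k x)) * conj (χ ζ κ′ x * φ i (x-k′ x)) ≈ w x * (φ i (x-k x) * φ i (x-k′ x))
    conj-twisted i x = trans (*-congˡ (trans (conj-* _ _) (*-congˡ (conj-φ i _)))) (*-interchange _ _ _ _)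

  twist : ∀ {N} → Carrier → (κ κ′ t : Fin N) → Carrier
  twist z κ κ′ t = pow z (toℕ κ ℕ.* toℕ t) * conj (pow z (toℕ κ′ ℕ.* toℕ t))

  S⁺ S⁻ : ∀ {N} → Carrier → (k κ k′ κ′ : Fin N) → Carrier
  S⁺ {N} z k κ k′ κ′ = ∑Fin N (λ t → twist z κ κ′ t * 𝟙 ⌊ t ⊖ k ≟ t ⊖ k′ ⌋)
  S⁻ {N} z k κ k′ κ′ = ∑Fin N (λ t → twist z κ κ′ t * 𝟙 ⌊ opposite (t ⊖ k) ≟ t ⊖ k′ ⌋)

  Gram≈∏S⁺-∏S⁻ : ∀ {n} (m : Fin n → ℕ) → (∀ ℓ → m ℓ % 2 ≡.≡ 1) → (ζ : Fin n → Carrier) (k κ k′ κ′ : G m) →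
                 Gram m ζ k κ k′ κ′ ≈ prodF (λ ℓ → S⁺ (ζ ℓ) (k ℓ) (κ ℓ) (k′ ℓ) (κ′ ℓ)) + - prodF (λ ℓ → S⁻ (ζ ℓ) (k ℓ) (κ ℓ) (k′ ℓ) (κ′ ℓ))
  Gram≈∏S⁺-∏S⁻ m odd ζ k κ k′ κ′ = begin
    Gram m ζ k κ k′ κ′
      ≈⟨ Gram≈∑G m odd ζ k κ k′ κ′ ⟩
    ∑G m (λ x → w x * (e (x-k x) (x-k′ x) + - e (oppG (x-k x)) (x-k′ x)))
      ≈⟨ ∑-cong (allG m) (λ x → trans (distribˡ _ _ _) (+-congˡ (sym (-‿distribʳ-* _ _)))) ⟩
    ∑G m (λ x → w x * e (x-k x) (x-k′ x) + - (w x * e (oppG (x-k x)) (x-k′ x)))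
      ≈⟨ ∑-+ (allG m) _ _ ⟩
    ∑G m (λ x → w x * e (x-k x) (x-k′ x)) + ∑G m (λ x → - (w x * e (oppG (x-k x)) (x-k′ x)))
      ≈⟨ +-cong (∑-cong (allG m) (w*e-factor x-k x-k′)) (trans (∑-neg (allG m) _) (-‿cong (∑-cong (allG m) (w*e-factor (λ x → oppG (x-k x)) x-k′)))) ⟩
    ∑G m (λ x → prodF (λ ℓ → twist (ζ ℓ) (κ ℓ) (κ′ ℓ) (x ℓ) * 𝟙 ⌊ x ℓ ⊖ k ℓ ≟ x ℓ ⊖ k′ ℓ ⌋))
      + - ∑G m (λ x → prodF (λ ℓ → twist (ζ ℓ) (κ ℓ) (κ′ ℓ) (x ℓ) * 𝟙 ⌊ opposite (x ℓ ⊖ k ℓ) ≟ x ℓ ⊖ k′ ℓ ⌋))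
                                                                                 ≈⟨ +-cong (∑G-prod m _) (-‿cong (∑G-prod m _)) ⟩
    prodF (λ ℓ → S⁺ (ζ ℓ) (k ℓ) (κ ℓ) (k′ ℓ) (κ′ ℓ)) + - prodF (λ ℓ → S⁻ (ζ ℓ) (k ℓ) (κ ℓ) (k′ ℓ) (κ′ ℓ)) ∎
    where
    x-k = λ x → subG x k
    x-k′ = λ x → subG x k′
    w = λ x → χ ζ κ x * conj (χ ζ κ′ x)
    w*e-factor : (u v : G m → G m) → ∀ x → w x * e (u x) (v x) ≈ prodF (λ ℓ → twist (ζ ℓ) (κ ℓ) (κ′ ℓ) (x ℓ) * 𝟙 ⌊ u x ℓ ≟ v x ℓ ⌋)
    w*e-factor u v x = begin
      χ ζ κ x * conj (χ ζ κ′ x) * e (u x) (v x) ≈⟨ *-cong (*-congˡ (conj-prodF (λ ℓ → pow (ζ ℓ) (toℕ (κ′ ℓ) ℕ.* toℕ (x ℓ))))) (𝟙-eqGᵇ (u x) (v x)) ⟩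
      prodF α * prodF β * prodF δ               ≈⟨ *-congʳ (prodF-* α β) ⟩
      prodF (λ ℓ → α ℓ * β ℓ) * prodF δ         ≈⟨ prodF-* (λ ℓ → α ℓ * β ℓ) δ ⟩
      prodF (λ ℓ → α ℓ * β ℓ * δ ℓ)             ∎
      where
      α β δ : Fin _ → Carrier
      α ℓ = pow (ζ ℓ) (toℕ (κ ℓ) ℕ.* toℕ (x ℓ))
      β ℓ = conj (pow (ζ ℓ) (toℕ (κ′ ℓ) ℕ.* toℕ (x ℓ)))
      δ ℓ = 𝟙 ⌊ u x ℓ ≟ v x ℓ ⌋

  module PrimitiveRoot {n : ℕ} {ζ : Carrier} (ζ-prim : IsPrimitiveRoot ζ (ℕ.suc n)) where
    open IsPrimitiveRoot ζ-prim

    pow-*N≈1 : ∀ k → pow ζ (k ℕ.* ℕ.suc n) ≈ 1#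
    pow-*N≈1 k = begin
      pow ζ (k ℕ.* ℕ.suc n)    ≡⟨ ≡.cong (pow ζ) (ℕₚ.*-comm k (ℕ.suc n)) ⟩
      pow ζ (ℕ.suc n ℕ.* k)    ≈⟨ pow-* ζ (ℕ.suc n) k ⟨
      pow (pow ζ (ℕ.suc n)) k  ≈⟨ pow-cong k root ⟩
      pow 1# k                 ≈⟨ pow-1# k ⟩
      1#                       ∎

    pow-≡-mod : ∀ {x y} → x ≡ y mod ℕ.suc n → pow ζ x ≈ pow ζ y
    pow-≡-mod {x} {y} (mk≡mod p q eq) = begin
      pow ζ x                          ≈⟨ *-identityʳ _ ⟨
      pow ζ x * 1#                     ≈⟨ *-congˡ (pow-*N≈1 p) ⟨
      pow ζ x * pow ζ (p ℕ.* ℕ.suc n)  ≈⟨ pow-+ ζ x _ ⟨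
      pow ζ (x ℕ.+ p ℕ.* ℕ.suc n)      ≡⟨ ≡.cong (pow ζ) eq ⟩
      pow ζ (y ℕ.+ q ℕ.* ℕ.suc n)      ≈⟨ pow-+ ζ y _ ⟩
      pow ζ y * pow ζ (q ℕ.* ℕ.suc n)  ≈⟨ *-congˡ (pow-*N≈1 q) ⟩
      pow ζ y * 1#                     ≈⟨ *-identityʳ _ ⟩
      pow ζ y                          ∎

    pow≈1⇒≡0 : ∀ {r} → r < ℕ.suc n → pow ζ r ≈ 1# → r ≡.≡ 0
    pow≈1⇒≡0 {ℕ.zero}  _   _     = ≡.refl
    pow≈1⇒≡0 {ℕ.suc r} r<N ζʳ≈1 = ⊥-elim (prim (ℕ.suc r) (s≤s z≤n) r<N ζʳ≈1)

    pow≈1⇒≡0-mod : ∀ a → pow ζ a ≈ 1# → a ≡ 0 mod ℕ.suc n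
    pow≈1⇒≡0-mod a ζᵃ≈1 = ≡-mod-trans (≡-mod-sym (%-≡-mod a))
      (≡⇒≡-mod (pow≈1⇒≡0 (m%n<n a (ℕ.suc n)) (trans (pow-≡-mod (%-≡-mod a)) ζᵃ≈1)))

    twist≈ : ∀ (κ κ′ t : Fin (ℕ.suc n)) → twist ζ κ κ′ t ≈ pow ζ ((toℕ κ ℕ.+ n ℕ.* toℕ κ′) ℕ.* toℕ t)
    twist≈ κ κ′ t = begin
      pow ζ u * conj (pow ζ u′)      ≈⟨ *-congˡ (conj-pow ζ u′) ⟩
      pow ζ u * pow (conj ζ) u′      ≈⟨ *-congˡ (trans (pow-cong u′ conj-ζ) (pow-* ζ n u′)) ⟩
      pow ζ u * pow ζ (n ℕ.* u′)     ≈⟨ pow-+ ζ u (n ℕ.* u′) ⟨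
      pow ζ (u ℕ.+ n ℕ.* u′)         ≡⟨ ≡.cong (pow ζ) ([x*t+n*[y*t]]≡[x+n*y]*t (toℕ κ) (toℕ κ′) (toℕ t) n) ⟩
      pow ζ ((toℕ κ ℕ.+ n ℕ.* toℕ κ′) ℕ.* toℕ t) ∎
      where
      import Data.Nat.Tactic.RingSolver as ℕ-Solver
      [x*t+n*[y*t]]≡[x+n*y]*t : ∀ x y t n → x ℕ.* t ℕ.+ n ℕ.* (y ℕ.* t) ≡.≡ (x ℕ.+ n ℕ.* y) ℕ.* t
      [x*t+n*[y*t]]≡[x+n*y]*t = ℕ-Solver.solve-∀
      u  = toℕ κ ℕ.* toℕ t
      u′ = toℕ κ′ ℕ.* toℕ t

    pow≈zpow : ∀ a z w → + a ≡.≡ z ℤ.+ + (w ℕ.* ℕ.suc n) → pow ζ a ≈ zpow ζ (ℕ.suc n) z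
    pow≈zpow a (+ c)     w eq = pow-≡-mod (mk≡mod 0 w (≡.trans (ℕₚ.+-identityʳ a) (+-injectiveʳ a c (w ℕ.* ℕ.suc n) eq)))
    pow≈zpow a -[1+ c ] w eq =
      trans (pow-≡-mod (+≡*⇒≡-mod {w = w} (-[1+]-injectiveʳ a c (w ℕ.* ℕ.suc n) eq))) (sym (pow-* ζ n (ℕ.suc c)))

  gramPhase : ∀ {N} → ℕ → (k κ k′ κ′ : Fin N) → ℕ
  gramPhase {N} h k κ k′ κ′ = phase (N ℕ.∸ 1) h (toℕ k) (toℕ κ) (toℕ k′) (toℕ κ′)

  S⁺-shift : ∀ {N} z (k κ k′ κ′ : Fin N) → ¬ k ≡.≡ k′ → S⁺ z k κ k′ κ′ ≈ 0#
  S⁺-shift {ℕ.zero}  z () κ k′ κ′ k≢k′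
  S⁺-shift {ℕ.suc n} z k κ k′ κ′ k≢k′ = ∑-zero (List.allFin (ℕ.suc n)) term≈0
    where
    term≈0 : ∀ t → twist z κ κ′ t * 𝟙 ⌊ t ⊖ k ≟ t ⊖ k′ ⌋ ≈ 0#
    term≈0 t with t ⊖ k ≟ t ⊖ k′
    ... | yes t-k≡t-k′ = ⊥-elim (k≢k′ (⊖-cancelˡ t k k′ t-k≡t-k′))
    ... | no  _        = zeroʳ _

  S⁺-frequency : IsDomain → ∀ {N z} → IsPrimitiveRoot z N → (k κ κ′ : Fin N) → ¬ κ ≡.≡ κ′ → S⁺ z k κ k κ′ ≈ 0#
  S⁺-frequency dom {ℕ.zero}      _      () κ κ′ κ≢κ′
  S⁺-frequency dom {ℕ.suc n} {z} z-prim k κ κ′ κ≢κ′ = begin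
    S⁺ z k κ k κ′                     ≈⟨ ∑-cong (List.allFin (ℕ.suc n)) term≈βᵗ ⟩
    ∑Fin (ℕ.suc n) (λ t → pow β (toℕ t)) ≈⟨ ∑Fin-pow≈0 dom (ℕ.suc n) β βᴺ≈1 β≉1 ⟩
    0#                                ∎
    where
    open PrimitiveRoot z-prim
    d = toℕ κ ℕ.+ n ℕ.* toℕ κ′
    β = pow z d

    term≈βᵗ : ∀ t → twist z κ κ′ t * 𝟙 ⌊ t ⊖ k ≟ t ⊖ k ⌋ ≈ pow β (toℕ t)
    term≈βᵗ t with t ⊖ k ≟ t ⊖ k
    ... | no  t-k≢t-k = ⊥-elim (t-k≢t-k ≡.refl)
    ... | yes _       = trans (*-identityʳ _) (trans (twist≈ κ κ′ t) (sym (pow-* z d (toℕ t))))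

    βᴺ≈1 : pow β (ℕ.suc n) ≈ 1#
    βᴺ≈1 = trans (pow-* z d (ℕ.suc n)) (pow-*N≈1 d)

    β≉1 : ¬ β ≈ 1#
    β≉1 β≈1 = κ≢κ′ (x+n*y≡0⇒x≡y κ κ′ (pow≈1⇒≡0-mod d β≈1))

  S⁺-vanishes : IsDomain → ∀ {N z} → IsPrimitiveRoot z N → (k κ k′ κ′ : Fin N) →
                ¬ (k ≡.≡ k′ × κ ≡.≡ κ′) → S⁺ z k κ k′ κ′ ≈ 0#
  S⁺-vanishes dom z-prim k κ k′ κ′ distinct with k ≟ k′
  ... | no  k≢k′   = S⁺-shift _ k κ k′ κ′ k≢k′
  ... | yes ≡.refl = S⁺-frequency dom z-prim k κ κ′ (λ κ≡κ′ → distinct (≡.refl , κ≡κ′))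

  S⁻≈ : ∀ {N z} → IsPrimitiveRoot z N → ∀ h → (∃ λ q → 2 ℕ.* h ≡.≡ 1 ℕ.+ q ℕ.* N) →
        (k κ k′ κ′ : Fin N) → S⁻ z k κ k′ κ′ ≈ pow z (gramPhase h k κ k′ κ′)
  S⁻≈ {ℕ.zero}      _      h _           () κ k′ κ′
  S⁻≈ {ℕ.suc n} {z} z-prim h (q , 2h≡1) k κ k′ κ′ = begin
    S⁻ z k κ k′ κ′
      ≈⟨ ∑-cong (List.allFin (ℕ.suc n)) (λ t → *-congˡ (reflexive (≡.cong 𝟙 (opposite≡⇔≡mid t)))) ⟩
    ∑Fin (ℕ.suc n) (λ t → twist z κ κ′ t * 𝟙 ⌊ t ≟ mid ⌋)
      ≈⟨ ∑-cong (List.allFin (ℕ.suc n)) (λ t → *-comm _ _) ⟩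
    ∑Fin (ℕ.suc n) (λ t → 𝟙 ⌊ t ≟ mid ⌋ * twist z κ κ′ t)
      ≈⟨ ∑Fin-δ (ℕ.suc n) mid (twist z κ κ′) ⟩
    twist z κ κ′ mid
      ≈⟨ twist≈ κ κ′ mid ⟩
    pow z (d ℕ.* toℕ mid)
      ≈⟨ pow-≡-mod (*-congˡ-mod d (toℕ-fromℕ<-% _)) ⟩
    pow z (d ℕ.* (h ℕ.* (toℕ k ℕ.+ toℕ k′ ℕ.+ n))) ∎
    where
    open PrimitiveRoot z-prim
    d = toℕ κ ℕ.+ n ℕ.* toℕ κ′
    mid = midpoint h q 2h≡1 k k′
    opposite≡⇔≡mid : ∀ t → ⌊ opposite (t ⊖ k) ≟ t ⊖ k′ ⌋ ≡.≡ ⌊ t ≟ mid ⌋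
    opposite≡⇔≡mid t = ≡.trans (isYes≗does a?) (≡.trans (does-⇔ (opposite-⊖≡⊖⇔≡midpoint h q 2h≡1 k k′ t) a? b?) (≡.sym (isYes≗does b?)))
      where
      a? = opposite (t ⊖ k) ≟ t ⊖ k′
      b? = t ≟ mid

  module _ (dom : IsDomain) {n : ℕ} (m : Fin n → ℕ) (odd : ∀ ℓ → m ℓ % 2 ≡.≡ 1)
           {ζ : Fin n → Carrier} (ζ-prim : ∀ ℓ → IsPrimitiveRoot (ζ ℓ) (m ℓ))
           (h : Fin n → ℕ) (h-half : ∀ ℓ → ∃ λ q → 2 ℕ.* h ℓ ≡.≡ 1 ℕ.+ q ℕ.* m ℓ) where

    ∏S⁺≈0 : (k κ k′ κ′ : G m) → DistinctPair k κ k′ κ′ → prodF (λ ℓ → S⁺ (ζ ℓ) (k ℓ) (κ ℓ) (k′ ℓ) (κ′ ℓ)) ≈ 0#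
    ∏S⁺≈0 k κ k′ κ′ distinct = prodF-zero _ ℓ (S⁺-vanishes dom (ζ-prim ℓ) (k ℓ) (κ ℓ) (k′ ℓ) (κ′ ℓ) ℓ-distinct)
      where
      ∃ℓ-distinct = ¬∀⟶∃¬ n (λ ℓ → k ℓ ≡.≡ k′ ℓ × κ ℓ ≡.≡ κ′ ℓ) (λ ℓ → (k ℓ ≟ k′ ℓ) ×-dec (κ ℓ ≟ κ′ ℓ))
                      (λ same → distinct ((λ ℓ → proj₁ (same ℓ)) , (λ ℓ → proj₂ (same ℓ))))
      ℓ = proj₁ ∃ℓ-distinct
      ℓ-distinct = proj₂ ∃ℓ-distinct

    Gram≈ : (k κ k′ κ′ : G m) → DistinctPair k κ k′ κ′ →
            Gram m ζ k κ k′ κ′ ≈ - prodF (λ ℓ → pow (ζ ℓ) (gramPhase (h ℓ) (k ℓ) (κ ℓ) (k′ ℓ) (κ′ ℓ)))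
    Gram≈ k κ k′ κ′ distinct = begin
      Gram m ζ k κ k′ κ′
        ≈⟨ Gram≈∏S⁺-∏S⁻ m odd ζ k κ k′ κ′ ⟩
      prodF (λ ℓ → S⁺ (ζ ℓ) (k ℓ) (κ ℓ) (k′ ℓ) (κ′ ℓ)) + - prodF (λ ℓ → S⁻ (ζ ℓ) (k ℓ) (κ ℓ) (k′ ℓ) (κ′ ℓ))
        ≈⟨ +-cong (∏S⁺≈0 k κ k′ κ′ distinct) (-‿cong (prodF-cong S⁻ℓ≈)) ⟩
      0# + - prodF (λ ℓ → pow (ζ ℓ) (gramPhase (h ℓ) (k ℓ) (κ ℓ) (k′ ℓ) (κ′ ℓ)))
        ≈⟨ +-identityˡ _ ⟩
      - prodF (λ ℓ → pow (ζ ℓ) (gramPhase (h ℓ) (k ℓ) (κ ℓ) (k′ ℓ) (κ′ ℓ))) ∎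
      where
      S⁻ℓ≈ = λ ℓ → S⁻≈ (ζ-prim ℓ) (h ℓ) (h-half ℓ) (k ℓ) (κ ℓ) (k′ ℓ) (κ′ ℓ)

  phase-triple : ∀ {N z} → IsPrimitiveRoot z N → ∀ h (k κ k̃ κ̃ k̂ κ̂ : Fin N) →
    pow z (gramPhase h k κ k̃ κ̃) * pow z (gramPhase h k̃ κ̃ k̂ κ̂) * pow z (gramPhase h k̂ κ̂ k κ)
      ≈ zpow z N (+ h ℤ.* (+ toℕ k ℤ.* (+ toℕ κ̂ ℤ.- + toℕ κ̃) ℤ.+ + toℕ k̃ ℤ.* (+ toℕ κ ℤ.- + toℕ κ̂)
                             ℤ.+ + toℕ k̂ ℤ.* (+ toℕ κ̃ ℤ.- + toℕ κ)))
  phase-triple {ℕ.zero}      _      h () κ k̃ κ̃ k̂ κ̂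
  phase-triple {ℕ.suc n} {z} z-prim h k κ k̃ κ̃ k̂ κ̂ = begin
    pow z P₁ * pow z P₂ * pow z P₃  ≈⟨ *-congʳ (pow-+ z P₁ P₂) ⟨
    pow z (P₁ ℕ.+ P₂) * pow z P₃    ≈⟨ pow-+ z (P₁ ℕ.+ P₂) P₃ ⟨
    pow z (P₁ ℕ.+ P₂ ℕ.+ P₃)        ≈⟨ pow≈zpow (P₁ ℕ.+ P₂ ℕ.+ P₃) Z (proj₁ cycle) (proj₂ cycle) ⟩
    zpow z (ℕ.suc n) Z              ∎
    where
    open PrimitiveRoot z-prim
    P₁ = gramPhase h k κ k̃ κ̃
    P₂ = gramPhase h k̃ κ̃ k̂ κ̂
    P₃ = gramPhase h k̂ κ̂ k κ
    Z = + h ℤ.* (+ toℕ k ℤ.* (+ toℕ κ̂ ℤ.- + toℕ κ̃) ℤ.+ + toℕ k̃ ℤ.* (+ toℕ κ ℤ.- + toℕ κ̂) ℤ.+ + toℕ k̂ ℤ.* (+ toℕ κ̃ ℤ.- + toℕ κ))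
    cycle = phase-cycle n h (toℕ k) (toℕ κ) (toℕ k̃) (toℕ κ̃) (toℕ k̂) (toℕ κ̂)

open import Data.Nat using (ℕ; suc; _≤_; _%_) renaming (_*_ to _*ℕ_; _+_ to _+ℕ_)
open import Data.Fin using (Fin; toℕ)
open import Data.Integer using (+_) renaming (_*_ to _*ℤ_)
open import Data.Product using (_×_; ∃)
open import Relation.Binary.PropositionalEquality using (_≡_)

expo₁≗expo₂ : ∀ {n} {m : Fin n → ℕ} (k κ k̃ κ̃ k̂ κ̂ : G m) ℓ → expo₁ k κ k̃ κ̃ k̂ κ̂ ℓ ≡ expo₂ k κ k̃ κ̃ k̂ κ̂ ℓ
expo₁≗expo₂ k κ k̃ κ̃ k̂ κ̂ ℓ =
  expo-alternating (+ toℕ (k ℓ)) (+ toℕ (κ ℓ)) (+ toℕ (k̃ ℓ)) (+ toℕ (κ̃ ℓ)) (+ toℕ (k̂ ℓ)) (+ toℕ (κ̂ ℓ))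
  where open PhaseArithmetic using (expo-alternating)

lemma5p2 : ∀ {a b : Level} (R : CommutativeRing a b)
             (conj : CommutativeRing.Carrier R → CommutativeRing.Carrier R) →
             let open CommutativeRing R
                 open Ops R conj
             in IsDomain → IsConjugation →
                (s : ℕ) (m : Fin (suc s) → ℕ) →
                (∀ ℓ → 3 ≤ m ℓ) → (∀ ℓ → m ℓ % 2 ≡ 1) →
                (ζ : Fin (suc s) → Carrier) → (∀ ℓ → IsPrimitiveRoot (ζ ℓ) (m ℓ)) →
                (k κ k̃ κ̃ k̂ κ̂ : G m) →
                DistinctPair k κ k̃ κ̃ → DistinctPair k̃ κ̃ k̂ κ̂ → DistinctPair k̂ κ̂ k κ →
                (h : Fin (suc s) → ℕ) → (∀ ℓ → ∃ λ q → 2 *ℕ h ℓ ≡ 1 +ℕ q *ℕ m ℓ) →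
                (Gram m ζ k κ k̃ κ̃ * Gram m ζ k̃ κ̃ k̂ κ̂ * Gram m ζ k̂ κ̂ k κ
                   ≈ - prodF (λ ℓ → zpow (ζ ℓ) (m ℓ) (+ h ℓ *ℤ expo₁ k κ k̃ κ̃ k̂ κ̂ ℓ)))
                × (Gram m ζ k κ k̃ κ̃ * Gram m ζ k̃ κ̃ k̂ κ̂ * Gram m ζ k̂ κ̂ k κ
                   ≈ - prodF (λ ℓ → zpow (ζ ℓ) (m ℓ) (+ h ℓ *ℤ expo₂ k κ k̃ κ̃ k̂ κ̂ ℓ)))
lemma5p2 R conj dom isConj s m _ odd ζ ζ-prim k κ k̃ κ̃ k̂ κ̂ d₁ d₂ d₃ h h-half =
  triple , trans triple (-‿cong (prodF-cong λ ℓ → reflexive (≡.cong (λ e → zpow (ζ ℓ) (m ℓ) (+ h ℓ *ℤ e)) (expo₁≗expo₂ k κ k̃ κ̃ k̂ κ̂ ℓ))))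
  where
  open CommutativeRing R
  open Ops R conj
  open Sums R conj using (prodF-cong; prodF-*₃; -x*-y*-z≈-[x*y*z])
  open GramEntries R conj isConj
  open import Data.Product using (_,_)
  open import Relation.Binary.Reasoning.Setoid setoid
  import Relation.Binary.PropositionalEquality as ≡

  P : (k κ k′ κ′ : G m) → Fin (suc s) → Carrier
  P k κ k′ κ′ ℓ = pow (ζ ℓ) (gramPhase (h ℓ) (k ℓ) (κ ℓ) (k′ ℓ) (κ′ ℓ))

  Gram≈-∏P : ∀ {k κ k′ κ′} → DistinctPair k κ k′ κ′ → Gram m ζ k κ k′ κ′ ≈ - prodF (P k κ k′ κ′)
  Gram≈-∏P = Gram≈ dom m odd ζ-prim h h-half _ _ _ _

  triple = begin
    Gram m ζ k κ k̃ κ̃ * Gram m ζ k̃ κ̃ k̂ κ̂ * Gram m ζ k̂ κ̂ k κ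
      ≈⟨ *-cong (*-cong (Gram≈-∏P d₁) (Gram≈-∏P d₂)) (Gram≈-∏P d₃) ⟩
    - prodF (P k κ k̃ κ̃) * - prodF (P k̃ κ̃ k̂ κ̂) * - prodF (P k̂ κ̂ k κ)
      ≈⟨ trans (-x*-y*-z≈-[x*y*z] _ _ _) (-‿cong (prodF-*₃ (P k κ k̃ κ̃) (P k̃ κ̃ k̂ κ̂) (P k̂ κ̂ k κ))) ⟩
    - prodF (λ ℓ → P k κ k̃ κ̃ ℓ * P k̃ κ̃ k̂ κ̂ ℓ * P k̂ κ̂ k κ ℓ)
      ≈⟨ -‿cong (prodF-cong λ ℓ → phase-triple (ζ-prim ℓ) (h ℓ) (k ℓ) (κ ℓ) (k̃ ℓ) (κ̃ ℓ) (k̂ ℓ) (κ̂ ℓ)) ⟩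
    - prodF (λ ℓ → zpow (ζ ℓ) (m ℓ) (+ h ℓ *ℤ expo₁ k κ k̃ κ̃ k̂ κ̂ ℓ)) ∎
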